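{- There is a recursive (computable) real $X\in\{0,1\}^\omega$ which is $\mathrm{BP}$ random.
   Context: For a finite string $\sigma$, $[\sigma]$ is the set of reals extending $\sigma$, and $[G]=\bigcup_{\sigma\in G}[\sigma]$. $\mu$ is the uniform measure on $\{0,1\}^\omega$. A primitive recursive test is a sequence of clopen sets $U_n=[G_n]$, where the finite sets $G_n$ of strings are given by a primitive recursive function ($g(n)$ codes $G_n$), and $\mu(U_n)\le 2^{ -n}$. $X$ is $\mathrm{BP}$ random if for every primitive recursive test there is $n$ with $X\notin U_n$. Equivalently, $X$ is $\mathrm{BP}$ random iff there are no primitive recursive $M:\{0,1\}^*\to\{0,1\}^*$ and primitive recursive $f$ with $C_M(X\upharpoonright f(c))\le f(c)-c$ for all $c$. Here $C_M(\tau)$ is the least $|\sigma|$ with $M(\sigma)=\tau$. -}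

module Defs where

open import Data.Nat using (ℕ; zero; suc; _+_; _*_; _^_; _≤_; _<_; ⌊_/2⌋)
open import Data.Bool using (Bool; true; false; if_then_else_; _∨_)
open import Data.List using (List; []; _∷_; map; upTo; take; length; concatMap)
open import Data.Bool.ListAction using (any)
open import Data.Nat.ListAction using (sum)
open import Data.Vec using (Vec; []; _∷_; lookup)
open import Data.Fin using (Fin)
open import Data.Product using (Σ; ∃; _×_)
open import Relation.Binary.PropositionalEquality using (_≡_)
open import Relation.Nullary using (¬_)

Real : Set
Real = ℕ → Bool

Str : Set
Str = List Bool

_↾_ : Real → ℕ → Str
X ↾ k = map X (upTo k)

data PR : ℕ → Set where
  zeroF : ∀ {k} → PR k
  succF : PR 1
  proj  : ∀ {k} → Fin k → PR k
  comp  : ∀ {k m} → PR m → Vec (PR k) m → PR k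
  prec  : ∀ {k} → PR k → PR (suc (suc k)) → PR (suc k)

mutual
  evalPR : ∀ {k} → PR k → Vec ℕ k → ℕ
  evalPR zeroF xs = 0
  evalPR succF (x ∷ []) = suc x
  evalPR (proj i) xs = lookup xs i
  evalPR (comp f gs) xs = evalPR f (evalPRs gs xs)
  evalPR (prec g h) (zero ∷ xs) = evalPR g xs
  evalPR (prec g h) (suc y ∷ xs) = evalPR h (y ∷ evalPR (prec g h) (y ∷ xs) ∷ xs)

  evalPRs : ∀ {k m} → Vec (PR k) m → Vec ℕ k → Vec ℕ m
  evalPRs [] xs = []
  evalPRs (g ∷ gs) xs = evalPR g xs ∷ evalPRs gs xs

data Rec : ℕ → Set where
  zeroR : ∀ {k} → Rec k
  succR : Rec 1
  projR : ∀ {k} → Fin k → Rec k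
  compR : ∀ {k m} → Rec m → Vec (Rec k) m → Rec k
  precR : ∀ {k} → Rec k → Rec (suc (suc k)) → Rec (suc k)
  muR   : ∀ {k} → Rec (suc k) → Rec k

mutual
  data _⊢_⇓_ : ∀ {k} → Rec k → Vec ℕ k → ℕ → Set where
    ⇓zero : ∀ {k} {xs : Vec ℕ k} → zeroR ⊢ xs ⇓ 0
    ⇓succ : ∀ {x} → succR ⊢ (x ∷ []) ⇓ suc x
    ⇓proj : ∀ {k} {i : Fin k} {xs} → projR i ⊢ xs ⇓ lookup xs i
    ⇓comp : ∀ {k m} {f : Rec m} {gs : Vec (Rec k) m} {xs ys y} →
            gs ⊢* xs ⇓ ys → f ⊢ ys ⇓ y → compR f gs ⊢ xs ⇓ y
    ⇓prec0 : ∀ {k} {g : Rec k} {h} {xs y} →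
             g ⊢ xs ⇓ y → precR g h ⊢ (zero ∷ xs) ⇓ y
    ⇓precS : ∀ {k} {g : Rec k} {h} {xs n z y} →
             precR g h ⊢ (n ∷ xs) ⇓ z → h ⊢ (n ∷ z ∷ xs) ⇓ y →
             precR g h ⊢ (suc n ∷ xs) ⇓ y
    ⇓mu : ∀ {k} {f : Rec (suc k)} {xs y} →
          f ⊢ (y ∷ xs) ⇓ 0 →
          (∀ z → z < y → ∃ λ m → f ⊢ (z ∷ xs) ⇓ suc m) →
          muR f ⊢ xs ⇓ y

  data _⊢*_⇓_ : ∀ {k m} → Vec (Rec k) m → Vec ℕ k → Vec ℕ m → Set where
    ⇓[] : ∀ {k} {xs : Vec ℕ k} → [] ⊢* xs ⇓ []
    ⇓∷  : ∀ {k m} {g : Rec k} {gs : Vec (Rec k) m} {xs y ys} →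
          g ⊢ xs ⇓ y → gs ⊢* xs ⇓ ys → (g ∷ gs) ⊢* xs ⇓ (y ∷ ys)

bitℕ : Bool → ℕ
bitℕ false = 0
bitℕ true  = 1

Computes : Rec 1 → Real → Set
Computes e X = ∀ n → e ⊢ (n ∷ []) ⇓ bitℕ (X n)

Recursive : Real → Set
Recursive X = Σ (Rec 1) λ e → Computes e X

-- Coding of finite sets of strings by natural numbers
-- (canonical indices: string σ belongs to the set coded by c iff
--  bit number idx σ of the binary expansion of c is 1)

-- bijection {0,1}* → ℕ
idx : Str → ℕ
idx [] = 0
idx (false ∷ σ) = suc (2 * idx σ)
idx (true  ∷ σ) = suc (suc (2 * idx σ))

parity : ℕ → Bool
parity zero = false
parity (suc zero) = true
parity (suc (suc n)) = parity n

testbit : ℕ → ℕ → Bool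
testbit c zero    = parity c
testbit c (suc i) = testbit ⌊ c /2⌋ i

_∈S_ : Str → ℕ → Bool
σ ∈S c = testbit c (idx σ)

_∈[_] : Real → ℕ → Set
X ∈[ c ] = ∃ λ k → (X ↾ k) ∈S c ≡ true

strings : ℕ → List Str
strings zero = [] ∷ []
strings (suc L) = concatMap (λ σ → (false ∷ σ) ∷ (true ∷ σ) ∷ []) (strings L)

-- τ has a prefix in G_c  (i.e. [τ] ⊆ [G_c])
hasPrefixIn : Str → ℕ → Bool
hasPrefixIn τ c = any (λ k → take k τ ∈S c) (upTo (suc (length τ)))

count : ℕ → ℕ → ℕ
count c L = sum (map (λ τ → if hasPrefixIn τ c then 1 else 0) (strings L))

-- μ([G_c]) ≤ 2^{-n}, written out for the clopen set [G_c]: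
-- for every L, #{τ ∈ 2^L : [τ] ⊆ [G_c]} · 2^n ≤ 2^L
MeasureLE : ℕ → ℕ → Set
MeasureLE c n = ∀ L → count c L * 2 ^ n ≤ 2 ^ L

IsPRTest : PR 1 → Set
IsPRTest g = ∀ n → MeasureLE (evalPR g (n ∷ [])) n

BPRandom : Real → Set
BPRandom X = (g : PR 1) → IsPRTest g →
             ∃ λ n → ¬ (X ∈[ evalPR g (n ∷ []) ])

-- X is built in stages, one for each code E of a primitive recursive function.  When stage E
-- starts, the first ℓ bits of X are fixed; let c be the value of the E-th function at ℓ + 1.
-- If [G_c] has measure at most 2^-(ℓ+1), then at most 2^c of the 2^(c+1) extensions of the
-- current prefix by c + 1 bits have a prefix in G_c, so one of them has none and is appended;
-- as G_c contains no string longer than c, X then avoids [G_c].  Each stage only evaluates a primitive recursive function,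
-- which a universal stack machine does in finitely many steps; running the machine with a
-- fuel bound and minimising over sufficient fuel shows that X is recursive.

module Submission where

open import Defs
open import Data.Bool using (Bool; true; false; if_then_else_)
open import Data.Bool.Properties using (∨-zeroʳ)
open import Data.Bool.ListAction using (any)
open import Data.Empty using (⊥; ⊥-elim)
open import Data.Fin using (Fin; #_; toℕ) renaming (zero to fzero; suc to fsuc)
open import Data.List using (List; []; _∷_; _∷ʳ_; length; _++_; _ʳ++_; map; foldr; drop; applyUpTo; take; upTo; concatMap)
open import Data.List.Properties using (length-applyUpTo; applyUpTo-∷ʳ; map-upTo; drop-[]; reverse-involutive)
open import Data.Nat using (ℕ; zero; suc; _+_; _*_; _∸_; _^_; _≤_; _<_; _⊔_; z≤n; s≤s; pred; ⌊_/2⌋)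
open import Data.Nat.GeneralisedArithmetic using (fold; fold-+; iterate-is-fold)
open import Data.Nat.ListAction using (sum)
open import Data.Nat.Properties
open import Data.Nat.Tactic.RingSolver using (solve-∀)
open import Data.Product using (Σ; ∃; _×_; _,_; proj₁; proj₂)
open import Data.Sum using (inj₁; inj₂; [_,_])
open import Data.Vec using (Vec; []; _∷_; head; tail; lookup; tabulate; toList)
open import Data.Vec.Properties using (tabulate∘lookup)
open import Relation.Binary.Construct.Closure.ReflexiveTransitive using (Star; ε; _◅_; _◅◅_)
open import Relation.Binary.Definitions using (tri<; tri≈; tri>)
open import Function using (_∘_)
open import Relation.Binary.PropositionalEquality using (_≡_; _≢_; refl; sym; trans; cong; cong₂; subst; module ≡-Reasoning)
open import Relation.Nullary using (¬_)

Computable : (k : ℕ) → (Vec ℕ k → ℕ) → Set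
Computable k f = Σ (Rec k) λ e → ∀ xs → e ⊢ xs ⇓ f xs

Computable* : (k m : ℕ) → (Vec ℕ k → Vec ℕ m) → Set
Computable* k m F = Σ (Vec (Rec k) m) λ es → ∀ xs → es ⊢* xs ⇓ F xs

-- Records, so that a certificate determines its function during unification; stated through
-- lookup so that projections and composites match them without η-conversion.
record Computable₁ (f : ℕ → ℕ) : Set where
  constructor computable₁
  field program₁ : Computable 1 λ v → f (lookup v (# 0))

record Computable₂ (f : ℕ → ℕ → ℕ) : Set where
  constructor computable₂
  field program₂ : Computable 2 λ v → f (lookup v (# 0)) (lookup v (# 1))

record Computable₃ (f : ℕ → ℕ → ℕ → ℕ) : Set where
  constructor computable₃
  field program₃ : Computable 3 λ v → f (lookup v (# 0)) (lookup v (# 1)) (lookup v (# 2))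

computable-ext : ∀ {k} {f g : Vec ℕ k → ℕ} → (∀ xs → f xs ≡ g xs) → Computable k f → Computable k g
computable-ext f≗g (e , e⇓) = e , λ xs → subst (e ⊢ xs ⇓_) (f≗g xs) (e⇓ xs)

computable₁-ext : ∀ {f g} → (∀ x → f x ≡ g x) → Computable₁ f → Computable₁ g
computable₁-ext f≗g (computable₁ c) = computable₁ (computable-ext (λ _ → f≗g _) c)

computable₂-ext : ∀ {f g} → (∀ x y → f x y ≡ g x y) → Computable₂ f → Computable₂ g
computable₂-ext f≗g (computable₂ c) = computable₂ (computable-ext (λ _ → f≗g _ _) c)

[]ᶜ : ∀ {k} → Computable* k 0 (λ _ → [])
[]ᶜ = [] , λ _ → ⇓[]

infixr 5 _∷ᶜ_
_∷ᶜ_ : ∀ {k m f F} → Computable k f → Computable* k m F → Computable* k (suc m) (λ xs → f xs ∷ F xs)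
(e , e⇓) ∷ᶜ (es , es⇓) = e ∷ es , λ xs → ⇓∷ (e⇓ xs) (es⇓ xs)

composeᶜ : ∀ {k m f F} → Computable m f → Computable* k m F → Computable k (λ xs → f (F xs))
composeᶜ (e , e⇓) (es , es⇓) = compR e es , λ xs → ⇓comp (es⇓ xs) (e⇓ _)

varᶜ : ∀ {k} (i : Fin k) → Computable k (λ xs → lookup xs i)
varᶜ i = projR i , λ _ → ⇓proj

zeroᶜ : ∀ {k} → Computable k (λ _ → 0)
zeroᶜ = zeroR , λ _ → ⇓zero

sucᶜ : Computable₁ suc
sucᶜ = computable₁ (succR , λ { (x ∷ []) → ⇓succ })

primRec : ∀ {k} → (Vec ℕ k → ℕ) → (Vec ℕ (suc (suc k)) → ℕ) → Vec ℕ (suc k) → ℕ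
primRec g h (zero ∷ xs) = g xs
primRec g h (suc y ∷ xs) = h (y ∷ primRec g h (y ∷ xs) ∷ xs)

primRecᶜ : ∀ {k g h} → Computable k g → Computable (suc (suc k)) h → Computable (suc k) (primRec g h)
primRecᶜ {g = g} {h} (eg , eg⇓) (eh , eh⇓) = precR eg eh , run
  where
  run : ∀ xs → precR eg eh ⊢ xs ⇓ primRec g h xs
  run (zero ∷ xs) = ⇓prec0 (eg⇓ xs)
  run (suc y ∷ xs) = ⇓precS (run (y ∷ xs)) (eh⇓ _)

apply₁ : ∀ {k f g} → Computable₁ f → Computable k g → Computable k (λ xs → f (g xs))
apply₁ (computable₁ cf) cg = composeᶜ cf (cg ∷ᶜ []ᶜ)

apply₂ : ∀ {k f g h} → Computable₂ f → Computable k g → Computable k h →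
         Computable k (λ xs → f (g xs) (h xs))
apply₂ (computable₂ cf) cg ch = composeᶜ cf (cg ∷ᶜ ch ∷ᶜ []ᶜ)

apply₃ : ∀ {k f g h i} → Computable₃ f → Computable k g → Computable k h → Computable k i →
         Computable k (λ xs → f (g xs) (h xs) (i xs))
apply₃ (computable₃ cf) cg ch ci = composeᶜ cf (cg ∷ᶜ ch ∷ᶜ ci ∷ᶜ []ᶜ)

constᶜ : ∀ {k} n → Computable k (λ _ → n)
constᶜ zero = zeroᶜ
constᶜ (suc n) = apply₁ sucᶜ (constᶜ n)

primRec₂ : (ℕ → ℕ) → (ℕ → ℕ → ℕ → ℕ) → ℕ → ℕ → ℕ
primRec₂ g h zero y = g y
primRec₂ g h (suc x) y = h x (primRec₂ g h x y) y

primRec₂ᶜ : ∀ {g h} → Computable₁ g → Computable₃ h → Computable₂ (primRec₂ g h)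
primRec₂ᶜ {g} {h} (computable₁ cg) (computable₃ ch) = computable₂ (computable-ext agree (primRecᶜ cg ch))
  where
  agree : ∀ xs → primRec _ _ xs ≡ primRec₂ g h (lookup xs (# 0)) (lookup xs (# 1))
  agree (zero ∷ y ∷ []) = refl
  agree (suc x ∷ y ∷ []) = cong (λ r → h x r y) (agree (x ∷ y ∷ []))

primRec₁ : ℕ → (ℕ → ℕ → ℕ) → ℕ → ℕ
primRec₁ a h zero = a
primRec₁ a h (suc n) = h n (primRec₁ a h n)

primRec₁ᶜ : ∀ {a h} → Computable₂ h → Computable₁ (primRec₁ a h)
primRec₁ᶜ {a} {h} (computable₂ ch) = computable₁ (computable-ext agree (primRecᶜ (constᶜ a) ch))
  where
  agree : ∀ xs → primRec _ _ xs ≡ primRec₁ a h (lookup xs (# 0))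
  agree (zero ∷ []) = refl
  agree (suc n ∷ []) = cong (h n) (agree (n ∷ []))

+ᶜ : Computable₂ _+_
+ᶜ = computable₂-ext agree
       (primRec₂ᶜ {h = λ _ r _ → suc r} (computable₁ (varᶜ (# 0))) (computable₃ (apply₁ sucᶜ (varᶜ (# 1)))))
  where
  agree : ∀ x y → primRec₂ (λ y → y) (λ _ r _ → suc r) x y ≡ x + y
  agree zero y = refl
  agree (suc x) y = cong suc (agree x y)

*ᶜ : Computable₂ _*_
*ᶜ = computable₂-ext agree
       (primRec₂ᶜ {h = λ _ r y → y + r} (computable₁ (constᶜ 0)) (computable₃ (apply₂ +ᶜ (varᶜ (# 2)) (varᶜ (# 1)))))
  where
  agree : ∀ x y → primRec₂ (λ _ → 0) (λ _ r y → y + r) x y ≡ x * y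
  agree zero y = refl
  agree (suc x) y = cong (y +_) (agree x y)

predᶜ : Computable₁ pred
predᶜ = computable₁ (computable-ext (λ { (zero ∷ []) → refl ; (suc x ∷ []) → refl }) (primRecᶜ zeroᶜ (varᶜ (# 0))))

ifZero_then_else_ : ℕ → ℕ → ℕ → ℕ
ifZero zero then b else c = b
ifZero suc _ then b else c = c

ifZeroᶜ : Computable₃ ifZero_then_else_
ifZeroᶜ = computable₃ (computable-ext (λ { (zero ∷ b ∷ c ∷ []) → refl ; (suc a ∷ b ∷ c ∷ []) → refl })
                                     (primRecᶜ (varᶜ (# 0)) (varᶜ (# 3))))

foldᶜ : ∀ {s} → Computable₁ s → Computable₂ (λ n x → fold x s n)
foldᶜ {s} cs = computable₂-ext agree
  (primRec₂ᶜ {h = λ _ r _ → s r} (computable₁ (varᶜ (# 0))) (computable₃ (apply₁ cs (varᶜ (# 1)))))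
  where
  agree : ∀ n x → primRec₂ (λ y → y) (λ _ r _ → s r) n x ≡ fold x s n
  agree zero x = refl
  agree (suc n) x = cong s (agree n x)

fold-shift : ∀ {A : Set} (s : A → A) x n → fold (s x) s n ≡ s (fold x s n)
fold-shift s x n = trans (iterate-is-fold (s x) s n) (sym (iterate-is-fold x s (suc n)))

∸ᶜ : Computable₂ _∸_
∸ᶜ = computable₂-ext pred-fold (computable₂ (apply₂ (foldᶜ predᶜ) (varᶜ (# 1)) (varᶜ (# 0))))
  where
  pred-fold : ∀ x y → fold x pred y ≡ x ∸ y
  pred-fold x zero = refl
  pred-fold x (suc y) = trans (cong pred (pred-fold x y)) (pred[m∸n]≡m∸[1+n] x y)

2^ᶜ : Computable₁ (2 ^_)
2^ᶜ = computable₁-ext agree (primRec₁ᶜ {1} {λ _ r → 2 * r} (computable₂ (apply₂ *ᶜ (constᶜ 2) (varᶜ (# 1)))))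
  where
  agree : ∀ n → primRec₁ 1 (λ _ r → 2 * r) n ≡ 2 ^ n
  agree zero = refl
  agree (suc n) = cong (2 *_) (agree n)

-- Cantor pairing

abstract
  triangle : ℕ → ℕ
  triangle zero = 0
  triangle (suc s) = suc s + triangle s

  triangleᶜ : Computable₁ triangle
  triangleᶜ = computable₁-ext agree
    (primRec₁ᶜ {0} {λ n r → suc n + r} (computable₂ (apply₂ +ᶜ (apply₁ sucᶜ (varᶜ (# 0))) (varᶜ (# 1)))))
    where
    agree : ∀ n → primRec₁ 0 (λ n r → suc n + r) n ≡ triangle n
    agree zero = refl
    agree (suc n) = cong (suc n +_) (agree n)

  -- diagonal z is the s with triangle s ≤ z < triangle (suc s)
  diagonal : ℕ → ℕ
  diagonal = primRec₁ 0 λ z s → ifZero triangle (suc s) ∸ suc z then suc s else s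

  diagonalᶜ : Computable₁ diagonal
  diagonalᶜ = primRec₁ᶜ (computable₂
    (apply₃ ifZeroᶜ (apply₂ ∸ᶜ (apply₁ triangleᶜ (apply₁ sucᶜ (varᶜ (# 1)))) (apply₁ sucᶜ (varᶜ (# 0))))
                    (apply₁ sucᶜ (varᶜ (# 1)))
                    (varᶜ (# 1))))

  pair : ℕ → ℕ → ℕ
  pair a b = triangle (a + b) + b

  snd : ℕ → ℕ
  snd z = z ∸ triangle (diagonal z)

  fst : ℕ → ℕ
  fst z = diagonal z ∸ snd z

  pairᶜ : Computable₂ pair
  pairᶜ = computable₂ (apply₂ +ᶜ (apply₁ triangleᶜ (apply₂ +ᶜ (varᶜ (# 0)) (varᶜ (# 1)))) (varᶜ (# 1)))

  sndᶜ : Computable₁ snd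
  sndᶜ = computable₁ (apply₂ ∸ᶜ (varᶜ (# 0)) (apply₁ triangleᶜ (apply₁ diagonalᶜ (varᶜ (# 0)))))

  fstᶜ : Computable₁ fst
  fstᶜ = computable₁ (apply₂ ∸ᶜ (apply₁ diagonalᶜ (varᶜ (# 0))) (apply₁ sndᶜ (varᶜ (# 0))))

  triangle-mono : ∀ {s t} → s < t → triangle (suc s) ≤ triangle t
  triangle-mono {s} {suc t} (s≤s s≤t) with m≤n⇒m<n∨m≡n s≤t
  ... | inj₁ s<t = ≤-trans (triangle-mono s<t) (m≤n+m (triangle t) (suc t))
  ... | inj₂ refl = ≤-refl

  diagonal-bounds-step : ∀ z s d → d ≡ triangle (suc s) ∸ suc z → triangle s ≤ z × z < triangle (suc s) →
    let s′ = ifZero d then suc s else s in triangle s′ ≤ suc z × suc z < triangle (suc s′)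
  diagonal-bounds-step z s zero d≡ (_ , hi) = m∸n≡0⇒m≤n (sym d≡) , s≤s (≤-trans hi (m≤n+m _ (suc s)))
  diagonal-bounds-step z s (suc d) d≡ (lo , _) =
    m≤n⇒m≤1+n lo , ≰⇒> λ le → 0≢1+n (trans (sym (m≤n⇒m∸n≡0 le)) (sym d≡))

  diagonal-bounds : ∀ z → triangle (diagonal z) ≤ z × z < triangle (suc (diagonal z))
  diagonal-bounds zero = z≤n , s≤s z≤n
  diagonal-bounds (suc z) = diagonal-bounds-step z (diagonal z) _ refl (diagonal-bounds z)

  diagonal-unique : ∀ z s → triangle s ≤ z → z < triangle (suc s) → diagonal z ≡ s
  diagonal-unique z s lo hi with <-cmp (diagonal z) s | diagonal-bounds z
  ... | tri≈ _ d≡s _ | _ = d≡s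
  ... | tri< d<s _ _ | (_ , hi′) = ⊥-elim (<-irrefl refl (<-≤-trans hi′ (≤-trans (triangle-mono d<s) lo)))
  ... | tri> _ _ s<d | (lo′ , _) = ⊥-elim (<-irrefl refl (<-≤-trans hi (≤-trans (triangle-mono s<d) lo′)))

  diagonal-pair : ∀ a b → diagonal (pair a b) ≡ a + b
  diagonal-pair a b = diagonal-unique (pair a b) (a + b) (m≤m+n _ _) (begin-strict
    triangle (a + b) + b           <⟨ +-monoʳ-< (triangle (a + b)) (s≤s (m≤n+m b a)) ⟩
    triangle (a + b) + suc (a + b) ≡⟨ +-comm (triangle (a + b)) _ ⟩
    triangle (suc (a + b))         ∎)
    where open ≤-Reasoning

  snd-pair : ∀ a b → snd (pair a b) ≡ b
  snd-pair a b rewrite diagonal-pair a b = m+n∸m≡n (triangle (a + b)) b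

  fst-pair : ∀ a b → fst (pair a b) ≡ a
  fst-pair a b rewrite snd-pair a b | diagonal-pair a b = m+n∸n≡m a b

  snd≤diagonal : ∀ z → snd z ≤ diagonal z
  snd≤diagonal z = ≤-pred (+-cancelˡ-< (triangle (diagonal z)) _ _ (begin-strict
    triangle (diagonal z) + (z ∸ triangle (diagonal z)) ≡⟨ m+[n∸m]≡n (proj₁ (diagonal-bounds z)) ⟩
    z                                                   <⟨ proj₂ (diagonal-bounds z) ⟩
    triangle (suc (diagonal z))                         ≡⟨ +-comm (suc (diagonal z)) _ ⟩
    triangle (diagonal z) + suc (diagonal z)            ∎))
    where open ≤-Reasoning

  pair-fst-snd : ∀ z → pair (fst z) (snd z) ≡ z
  pair-fst-snd z rewrite m∸n+n≡m (snd≤diagonal z) = m+[n∸m]≡n (proj₁ (diagonal-bounds z))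

  fst-zero : fst 0 ≡ 0
  fst-zero = refl

  snd-zero : snd 0 ≡ 0
  snd-zero = refl

  snd≤ : ∀ z → snd z ≤ z
  snd≤ z = m∸n≤m z (triangle (diagonal z))

  fst≤ : ∀ z → fst z ≤ z
  fst≤ z = ≤-trans (m∸n≤m (diagonal z) (snd z)) (≤-trans (n≤triangle (diagonal z)) (proj₁ (diagonal-bounds z)))
    where
    n≤triangle : ∀ n → n ≤ triangle n
    n≤triangle zero = z≤n
    n≤triangle (suc n) = m≤m+n (suc n) (triangle n)

-- A universal machine for primitive recursive terms

data Term : Set where
  zeroᵗ succᵗ : Term
  projᵗ : ℕ → Term
  compᵗ : Term → List Term → Term
  precᵗ : Term → Term → Term

head₀ : List ℕ → ℕ
head₀ [] = 0
head₀ (x ∷ _) = x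

mutual
  eval : Term → List ℕ → ℕ
  eval zeroᵗ xs = 0
  eval succᵗ xs = suc (head₀ xs)
  eval (projᵗ i) xs = head₀ (drop i xs)
  eval (compᵗ f gs) xs = eval f (evals gs xs)
  eval (precᵗ g h) xs = evalRec g h (head₀ xs) (drop 1 xs)

  evals : List Term → List ℕ → List ℕ
  evals [] xs = []
  evals (g ∷ gs) xs = eval g xs ∷ evals gs xs

  evalRec : Term → Term → ℕ → List ℕ → ℕ
  evalRec g h zero ys = eval g ys
  evalRec g h (suc y) ys = eval h (y ∷ evalRec g h y ys ∷ ys)

-- A code is 0 for zeroᵗ, or 1 + pair tag a with tag 0, 1, 2, 3 for succᵗ, projᵗ a, and the
-- composition and recursion of the terms coded by the components of a; other tags code zeroᵗ.
mutual
  data IsCode : ℕ → Term → Set where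
    zero : IsCode 0 zeroᵗ
    tagged : ∀ {tag a u} → IsCodeTagged tag a u → IsCode (suc (pair tag a)) u

  data IsCodeTagged : ℕ → ℕ → Term → Set where
    succ : ∀ {a} → IsCodeTagged 0 a succᵗ
    proj : ∀ {a} → IsCodeTagged 1 a (projᵗ a)
    comp : ∀ {a f gs} → IsCode (fst a) f → AreCodes (snd a) gs → IsCodeTagged 2 a (compᵗ f gs)
    prec : ∀ {a g h} → IsCode (fst a) g → IsCode (snd a) h → IsCodeTagged 3 a (precᵗ g h)
    junk : ∀ {k a} → IsCodeTagged (4 + k) a zeroᵗ

  data AreCodes : ℕ → List Term → Set where
    [] : AreCodes 0 []
    _∷_ : ∀ {q g gs} → IsCode (fst q) g → AreCodes (snd q) gs → AreCodes (suc q) (g ∷ gs)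

-- Lists of numbers are coded with 0 for the empty list.
cons : ℕ → ℕ → ℕ
cons x l = suc (pair x l)

hd : ℕ → ℕ
hd l = fst (pred l)

tl : ℕ → ℕ
tl l = snd (pred l)

nth : ℕ → ℕ → ℕ
nth i l = hd (fold l tl i)

consᶜ : Computable₂ cons
consᶜ = computable₂ (apply₁ sucᶜ (apply₂ pairᶜ (varᶜ (# 0)) (varᶜ (# 1))))

hdᶜ : Computable₁ hd
hdᶜ = computable₁ (apply₁ fstᶜ (apply₁ predᶜ (varᶜ (# 0))))

tlᶜ : Computable₁ tl
tlᶜ = computable₁ (apply₁ sndᶜ (apply₁ predᶜ (varᶜ (# 0))))

nthᶜ : Computable₂ nth
nthᶜ = computable₂ (apply₁ hdᶜ (apply₂ (foldᶜ tlᶜ) (varᶜ (# 0)) (varᶜ (# 1))))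

-- A state is pair K S of a control stack K of instructions and a stack S of values; it is
-- final when K = 0.

evalInstr : ℕ → ℕ → ℕ
evalInstr t xs = pair 0 (pair t xs)

-- evaluate the argument terms gs, n results being already on the stack
composeInstr : ℕ → ℕ → ℕ → ℕ → ℕ
composeInstr f gs xs n = pair 1 (pair f (pair gs (pair xs n)))

-- move n results from the stack to the argument list acc, then evaluate f
gatherInstr : ℕ → ℕ → ℕ → ℕ
gatherInstr n acc f = pair 2 (pair n (pair acc f))

-- the value at y being on the stack, evaluate the step term h at y
recurseInstr : ℕ → ℕ → ℕ → ℕ
recurseInstr h y xs = pair 3 (pair h (pair y xs))

execEvalRec : ℕ → ℕ → ℕ → ℕ → ℕ → ℕ → ℕ → ℕ
execEvalRec y g h t xs K S =
  ifZero y then pair (cons (evalInstr g xs) K) S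
  else pair (cons (evalInstr t (cons (pred y) xs)) (cons (recurseInstr h (pred y) xs) K)) S

execEvalTagged : ℕ → ℕ → ℕ → ℕ → ℕ → ℕ → ℕ
execEvalTagged tag a t xs K S =
  ifZero tag then pair K (cons (suc (hd xs)) S)
  else ifZero pred tag then pair K (cons (nth a xs) S)
  else ifZero pred (pred tag) then pair (cons (composeInstr (fst a) (snd a) xs 0) K) S
  else ifZero pred (pred (pred tag)) then execEvalRec (hd xs) (fst a) (snd a) t (tl xs) K S
  else pair K (cons 0 S)

execEval : ℕ → ℕ → ℕ → ℕ → ℕ
execEval t xs K S = ifZero t then pair K (cons 0 S) else execEvalTagged (fst (pred t)) (snd (pred t)) t xs K S

execCompose : ℕ → ℕ → ℕ → ℕ → ℕ → ℕ → ℕ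
execCompose gs f xs n K S =
  ifZero gs then pair (cons (gatherInstr n 0 f) K) S
  else pair (cons (evalInstr (hd gs) xs) (cons (composeInstr f (tl gs) xs (suc n)) K)) S

execGather : ℕ → ℕ → ℕ → ℕ → ℕ → ℕ
execGather n acc f K S =
  ifZero n then pair (cons (evalInstr f acc) K) S
  else pair (cons (gatherInstr (pred n) (cons (hd S) acc) f) K) (tl S)

execRecurse : ℕ → ℕ → ℕ → ℕ → ℕ → ℕ
execRecurse h y xs K S = pair (cons (evalInstr h (cons y (cons (hd S) xs))) K) (tl S)

execInstr : ℕ → ℕ → ℕ → ℕ → ℕ
execInstr tag a K S =
  ifZero tag then execEval (fst a) (snd a) K S
  else ifZero pred tag then execCompose (fst (snd a)) (fst a) (fst (snd (snd a))) (snd (snd (snd a))) K S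
  else ifZero pred (pred tag) then execGather (fst a) (fst (snd a)) (snd (snd a)) K S
  else execRecurse (fst a) (fst (snd a)) (snd (snd a)) K S

step : ℕ → ℕ
step σ = ifZero fst σ then σ else execInstr (fst (hd (fst σ))) (snd (hd (fst σ))) (tl (fst σ)) (snd σ)

evalInstrᶜ : ∀ {k f g} → Computable k f → Computable k g → Computable k (λ v → evalInstr (f v) (g v))
evalInstrᶜ t xs = apply₂ pairᶜ (constᶜ 0) (apply₂ pairᶜ t xs)

composeInstrᶜ : ∀ {k f g h i} → Computable k f → Computable k g → Computable k h → Computable k i →
                Computable k (λ v → composeInstr (f v) (g v) (h v) (i v))
composeInstrᶜ f gs xs n = apply₂ pairᶜ (constᶜ 1) (apply₂ pairᶜ f (apply₂ pairᶜ gs (apply₂ pairᶜ xs n)))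

gatherInstrᶜ : ∀ {k f g h} → Computable k f → Computable k g → Computable k h →
               Computable k (λ v → gatherInstr (f v) (g v) (h v))
gatherInstrᶜ n acc f = apply₂ pairᶜ (constᶜ 2) (apply₂ pairᶜ n (apply₂ pairᶜ acc f))

recurseInstrᶜ : ∀ {k f g h} → Computable k f → Computable k g → Computable k h →
                Computable k (λ v → recurseInstr (f v) (g v) (h v))
recurseInstrᶜ h y xs = apply₂ pairᶜ (constᶜ 3) (apply₂ pairᶜ h (apply₂ pairᶜ y xs))

execEvalRecᶜ : Computable 7 λ v → execEvalRec (lookup v (# 0)) (lookup v (# 1)) (lookup v (# 2)) (lookup v (# 3))
                                               (lookup v (# 4)) (lookup v (# 5)) (lookup v (# 6))
execEvalRecᶜ = apply₃ ifZeroᶜ (varᶜ (# 0))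
  (apply₂ pairᶜ (apply₂ consᶜ (evalInstrᶜ (varᶜ (# 1)) (varᶜ (# 4))) (varᶜ (# 5))) (varᶜ (# 6)))
  (apply₂ pairᶜ (apply₂ consᶜ (evalInstrᶜ (varᶜ (# 3)) (apply₂ consᶜ (apply₁ predᶜ (varᶜ (# 0))) (varᶜ (# 4))))
                              (apply₂ consᶜ (recurseInstrᶜ (varᶜ (# 2)) (apply₁ predᶜ (varᶜ (# 0))) (varᶜ (# 4)))
                                            (varᶜ (# 5))))
                (varᶜ (# 6)))

execEvalTaggedᶜ : Computable 6 λ v → execEvalTagged (lookup v (# 0)) (lookup v (# 1)) (lookup v (# 2))
                                                     (lookup v (# 3)) (lookup v (# 4)) (lookup v (# 5))
execEvalTaggedᶜ =
  apply₃ ifZeroᶜ tag (apply₂ pairᶜ K (apply₂ consᶜ (apply₁ sucᶜ (apply₁ hdᶜ xs)) S))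
  (apply₃ ifZeroᶜ (apply₁ predᶜ tag) (apply₂ pairᶜ K (apply₂ consᶜ (apply₂ nthᶜ a xs) S))
  (apply₃ ifZeroᶜ (apply₁ predᶜ (apply₁ predᶜ tag))
    (apply₂ pairᶜ (apply₂ consᶜ (composeInstrᶜ (apply₁ fstᶜ a) (apply₁ sndᶜ a) xs (constᶜ 0)) K) S)
  (apply₃ ifZeroᶜ (apply₁ predᶜ (apply₁ predᶜ (apply₁ predᶜ tag)))
    (composeᶜ execEvalRecᶜ (apply₁ hdᶜ xs ∷ᶜ apply₁ fstᶜ a ∷ᶜ apply₁ sndᶜ a ∷ᶜ t ∷ᶜ apply₁ tlᶜ xs ∷ᶜ K ∷ᶜ S ∷ᶜ []ᶜ))
    (apply₂ pairᶜ K (apply₂ consᶜ (constᶜ 0) S)))))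
  where
  tag = varᶜ (# 0); a = varᶜ (# 1); t = varᶜ (# 2); xs = varᶜ (# 3); K = varᶜ (# 4); S = varᶜ (# 5)

execEvalᶜ : Computable 4 λ v → execEval (lookup v (# 0)) (lookup v (# 1)) (lookup v (# 2)) (lookup v (# 3))
execEvalᶜ = apply₃ ifZeroᶜ (varᶜ (# 0)) (apply₂ pairᶜ (varᶜ (# 2)) (apply₂ consᶜ (constᶜ 0) (varᶜ (# 3))))
  (composeᶜ execEvalTaggedᶜ (apply₁ fstᶜ (apply₁ predᶜ (varᶜ (# 0))) ∷ᶜ apply₁ sndᶜ (apply₁ predᶜ (varᶜ (# 0)))
                            ∷ᶜ varᶜ (# 0) ∷ᶜ varᶜ (# 1) ∷ᶜ varᶜ (# 2) ∷ᶜ varᶜ (# 3) ∷ᶜ []ᶜ))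

execComposeᶜ : Computable 6 λ v → execCompose (lookup v (# 0)) (lookup v (# 1)) (lookup v (# 2))
                                               (lookup v (# 3)) (lookup v (# 4)) (lookup v (# 5))
execComposeᶜ = apply₃ ifZeroᶜ gs
  (apply₂ pairᶜ (apply₂ consᶜ (gatherInstrᶜ n (constᶜ 0) f) K) S)
  (apply₂ pairᶜ (apply₂ consᶜ (evalInstrᶜ (apply₁ hdᶜ gs) xs)
                              (apply₂ consᶜ (composeInstrᶜ f (apply₁ tlᶜ gs) xs (apply₁ sucᶜ n)) K))
                S)
  where
  gs = varᶜ (# 0); f = varᶜ (# 1); xs = varᶜ (# 2); n = varᶜ (# 3); K = varᶜ (# 4); S = varᶜ (# 5)

execGatherᶜ : Computable 5 λ v → execGather (lookup v (# 0)) (lookup v (# 1)) (lookup v (# 2))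
                                             (lookup v (# 3)) (lookup v (# 4))
execGatherᶜ = apply₃ ifZeroᶜ n
  (apply₂ pairᶜ (apply₂ consᶜ (evalInstrᶜ f acc) K) S)
  (apply₂ pairᶜ (apply₂ consᶜ (gatherInstrᶜ (apply₁ predᶜ n) (apply₂ consᶜ (apply₁ hdᶜ S) acc) f) K)
                (apply₁ tlᶜ S))
  where
  n = varᶜ (# 0); acc = varᶜ (# 1); f = varᶜ (# 2); K = varᶜ (# 3); S = varᶜ (# 4)

execRecurseᶜ : Computable 5 λ v → execRecurse (lookup v (# 0)) (lookup v (# 1)) (lookup v (# 2))
                                               (lookup v (# 3)) (lookup v (# 4))
execRecurseᶜ = apply₂ pairᶜ
  (apply₂ consᶜ (evalInstrᶜ (varᶜ (# 0)) (apply₂ consᶜ (varᶜ (# 1)) (apply₂ consᶜ (apply₁ hdᶜ (varᶜ (# 4))) (varᶜ (# 2)))))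
                (varᶜ (# 3)))
  (apply₁ tlᶜ (varᶜ (# 4)))

execInstrᶜ : Computable 4 λ v → execInstr (lookup v (# 0)) (lookup v (# 1)) (lookup v (# 2)) (lookup v (# 3))
execInstrᶜ =
  apply₃ ifZeroᶜ tag (composeᶜ execEvalᶜ (apply₁ fstᶜ a ∷ᶜ apply₁ sndᶜ a ∷ᶜ K ∷ᶜ S ∷ᶜ []ᶜ))
  (apply₃ ifZeroᶜ (apply₁ predᶜ tag)
    (composeᶜ execComposeᶜ (a₁₀ ∷ᶜ apply₁ fstᶜ a ∷ᶜ apply₁ fstᶜ a₁₁ ∷ᶜ apply₁ sndᶜ a₁₁ ∷ᶜ K ∷ᶜ S ∷ᶜ []ᶜ))
  (apply₃ ifZeroᶜ (apply₁ predᶜ (apply₁ predᶜ tag))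
    (composeᶜ execGatherᶜ (apply₁ fstᶜ a ∷ᶜ a₁₀ ∷ᶜ a₁₁ ∷ᶜ K ∷ᶜ S ∷ᶜ []ᶜ))
    (composeᶜ execRecurseᶜ (apply₁ fstᶜ a ∷ᶜ a₁₀ ∷ᶜ a₁₁ ∷ᶜ K ∷ᶜ S ∷ᶜ []ᶜ))))
  where
  tag = varᶜ (# 0); a = varᶜ (# 1); K = varᶜ (# 2); S = varᶜ (# 3)
  a₁₀ = apply₁ fstᶜ (apply₁ sndᶜ a); a₁₁ = apply₁ sndᶜ (apply₁ sndᶜ a)

stepᶜ : Computable₁ step
stepᶜ = computable₁ (apply₃ ifZeroᶜ K σ
  (composeᶜ execInstrᶜ (apply₁ fstᶜ (apply₁ hdᶜ K) ∷ᶜ apply₁ sndᶜ (apply₁ hdᶜ K) ∷ᶜ apply₁ tlᶜ K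
                        ∷ᶜ apply₁ sndᶜ σ ∷ᶜ []ᶜ)))
  where
  σ = varᶜ (# 0); K = apply₁ fstᶜ σ
encode : List ℕ → ℕ
encode [] = 0
encode (x ∷ xs) = cons x (encode xs)

hd-encode : ∀ xs → hd (encode xs) ≡ head₀ xs
hd-encode [] = fst-zero
hd-encode (x ∷ xs) = fst-pair x (encode xs)

fold-tl-encode : ∀ n xs → fold (encode xs) tl n ≡ encode (drop n xs)
fold-tl-encode zero xs = refl
fold-tl-encode (suc n) [] = trans (cong tl (fold-tl-encode n [])) (trans (cong (tl ∘ encode) (drop-[] n)) snd-zero)
fold-tl-encode (suc n) (x ∷ xs) = begin
  fold (cons x (encode xs)) tl (suc n) ≡⟨ sym (fold-shift tl (cons x (encode xs)) n) ⟩
  fold (tl (cons x (encode xs))) tl n  ≡⟨ cong (λ l → fold l tl n) (snd-pair x (encode xs)) ⟩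
  fold (encode xs) tl n                ≡⟨ fold-tl-encode n xs ⟩
  encode (drop n xs)                   ∎
  where open ≡-Reasoning

nth-encode : ∀ i xs → nth i (encode xs) ≡ head₀ (drop i xs)
nth-encode i xs = trans (cong hd (fold-tl-encode i xs)) (hd-encode (drop i xs))

_⟶_ : ℕ → ℕ → Set
σ ⟶ τ = step σ ≡ τ

_⟶*_ : ℕ → ℕ → Set
_⟶*_ = Star _⟶_

≡⇒⟶* : ∀ {σ τ} → σ ≡ τ → σ ⟶* τ
≡⇒⟶* refl = ε

⟶*⇒fold : ∀ {σ τ} → σ ⟶* τ → ∃ λ n → fold σ step n ≡ τ
⟶*⇒fold ε = 0 , refl
⟶*⇒fold {σ} (σ⟶ ◅ rest) with ⟶*⇒fold rest
... | n , eq = suc n , trans (sym (fold-shift step σ n)) (trans (cong (λ τ → fold τ step n) σ⟶) eq)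

step-final : ∀ S → step (pair 0 S) ≡ pair 0 S
step-final S rewrite fst-pair 0 S = refl

step-instr : ∀ tag a K S → pair (cons (pair tag a) K) S ⟶ execInstr tag a K S
step-instr tag a K S
  rewrite fst-pair (cons (pair tag a) K) S | snd-pair (cons (pair tag a) K) S
        | fst-pair (pair tag a) K | snd-pair (pair tag a) K | fst-pair tag a | snd-pair tag a = refl

step-eval : ∀ t X K S → pair (cons (evalInstr t X) K) S ⟶ execEval t X K S
step-eval t X K S rewrite step-instr 0 (pair t X) K S | fst-pair t X | snd-pair t X = refl

step-evalTagged : ∀ tag a X K S → let t = suc (pair tag a) in
                  pair (cons (evalInstr t X) K) S ⟶ execEvalTagged tag a t X K S
step-evalTagged tag a X K S rewrite step-eval (suc (pair tag a)) X K S | fst-pair tag a | snd-pair tag a = refl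

step-compose : ∀ f gs X n K S → pair (cons (composeInstr f gs X n) K) S ⟶ execCompose gs f X n K S
step-compose f gs X n K S
  rewrite step-instr 1 (pair f (pair gs (pair X n))) K S | fst-pair f (pair gs (pair X n))
        | snd-pair f (pair gs (pair X n)) | fst-pair gs (pair X n) | snd-pair gs (pair X n)
        | fst-pair X n | snd-pair X n = refl

step-gather : ∀ n acc f K S → pair (cons (gatherInstr n acc f) K) S ⟶ execGather n acc f K S
step-gather n acc f K S
  rewrite step-instr 2 (pair n (pair acc f)) K S | fst-pair n (pair acc f) | snd-pair n (pair acc f)
        | fst-pair acc f | snd-pair acc f = refl

step-recurse : ∀ h y X K S → pair (cons (recurseInstr h y X) K) S ⟶ execRecurse h y X K S
step-recurse h y X K S
  rewrite step-instr 3 (pair h (pair y X)) K S | fst-pair h (pair y X) | snd-pair h (pair y X)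
        | fst-pair y X | snd-pair y X = refl

push : List ℕ → ℕ → ℕ
push rs S = foldr cons S rs

gather-run : ∀ f rs acc K S →
  pair (cons (gatherInstr (length rs) (encode acc) f) K) (push rs S) ⟶*
  pair (cons (evalInstr f (encode (rs ʳ++ acc))) K) S
gather-run f [] acc K S = step-gather 0 (encode acc) f K S ◅ ε
gather-run f (r ∷ rs) acc K S =
  trans (step-gather _ _ f K _)
        (cong₂ (λ r′ S′ → pair (cons (gatherInstr (length rs) (cons r′ (encode acc)) f) K) S′)
               (fst-pair r (push rs S)) (snd-pair r (push rs S)))
  ◅ gather-run f rs (r ∷ acc) K S

mutual
  eval-run : ∀ {t u} → IsCode t u → ∀ xs K S →
             pair (cons (evalInstr t (encode xs)) K) S ⟶* pair K (cons (eval u xs) S)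
  eval-run zero xs K S = step-eval 0 _ K S ◅ ε
  eval-run (tagged {tag} {a} c) xs K S = step-evalTagged tag a (encode xs) K S ◅ evalTagged-run c xs K S

  evalTagged-run : ∀ {tag a u} → IsCodeTagged tag a u → ∀ xs K S →
    execEvalTagged tag a (suc (pair tag a)) (encode xs) K S ⟶* pair K (cons (eval u xs) S)
  evalTagged-run succ xs K S = ≡⇒⟶* (cong (λ v → pair K (cons (suc v) S)) (hd-encode xs))
  evalTagged-run (proj {a}) xs K S = ≡⇒⟶* (cong (λ v → pair K (cons v S)) (nth-encode a xs))
  evalTagged-run (comp {a} {f} {gs} cf cgs) xs K S =
    compose-run cgs (fst a) xs [] K S
    ◅◅ gather-run (fst a) (evals gs xs ʳ++ []) [] K S
    ◅◅ ≡⇒⟶* (cong (λ l → pair (cons (evalInstr (fst a) (encode l)) K) S) (reverse-involutive (evals gs xs)))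
    ◅◅ eval-run cf (evals gs xs) K S
  evalTagged-run (prec cg ch) xs K S =
    ≡⇒⟶* (cong₂ (λ y X → execEvalRec y _ _ _ X K S) (hd-encode xs) (fold-tl-encode 1 xs))
    ◅◅ rec-run cg ch (head₀ xs) (drop 1 xs) K S
  evalTagged-run junk xs K S = ε

  compose-run : ∀ {gsc gs} → AreCodes gsc gs → ∀ f xs rs K S →
    pair (cons (composeInstr f gsc (encode xs) (length rs)) K) (push rs S) ⟶*
    pair (cons (gatherInstr (length (evals gs xs ʳ++ rs)) 0 f) K) (push (evals gs xs ʳ++ rs) S)
  compose-run [] f xs rs K S = step-compose f 0 _ _ K _ ◅ ε
  compose-run (_∷_ {g = g} cg cgs) f xs rs K S =
    step-compose f _ _ _ K _ ◅ eval-run cg xs _ (push rs S) ◅◅ compose-run cgs f xs (eval g xs ∷ rs) K S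

  rec-run : ∀ {a g h} → IsCode (fst a) g → IsCode (snd a) h → ∀ y ys K S →
    execEvalRec y (fst a) (snd a) (suc (pair 3 a)) (encode ys) K S ⟶* pair K (cons (evalRec g h y ys) S)
  rec-run cg ch zero ys K S = eval-run cg ys K S
  rec-run {a} {g} {h} cg ch (suc y) ys K S =
    step-evalTagged 3 a (encode (y ∷ ys)) K′ S
    ◅ ≡⇒⟶* (cong₂ (λ y′ X → execEvalRec y′ (fst a) (snd a) (suc (pair 3 a)) X K′ S)
                  (fst-pair y (encode ys)) (snd-pair y (encode ys)))
    ◅◅ rec-run cg ch y ys K′ S
    ◅◅ trans (step-recurse (snd a) y (encode ys) K _)
             (cong₂ (λ r S′ → pair (cons (evalInstr (snd a) (encode (y ∷ r ∷ ys))) K) S′)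
                    (fst-pair (evalRec g h y ys) S) (snd-pair (evalRec g h y ys) S))
    ◅ eval-run ch (y ∷ evalRec g h y ys ∷ ys) K S
    where
    K′ = cons (recurseInstr (snd a) y (encode ys)) K

pair-injective : ∀ {a b a′ b′} → pair a b ≡ pair a′ b′ → a ≡ a′ × b ≡ b′
pair-injective {a} {b} {a′} {b′} eq =
  trans (sym (fst-pair a b)) (trans (cong fst eq) (fst-pair a′ b′)) ,
  trans (sym (snd-pair a b)) (trans (cong snd eq) (snd-pair a′ b′))

mutual
  isCode-unique : ∀ {t t′ u u′} → IsCode t u → IsCode t′ u′ → t ≡ t′ → u ≡ u′
  isCode-unique zero zero _ = refl
  isCode-unique zero (tagged _) ()
  isCode-unique (tagged _) zero ()
  isCode-unique (tagged c) (tagged c′) eq with pair-injective (suc-injective eq)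
  ... | refl , refl = isCodeTagged-unique c c′

  isCodeTagged-unique : ∀ {tag a u u′} → IsCodeTagged tag a u → IsCodeTagged tag a u′ → u ≡ u′
  isCodeTagged-unique succ succ = refl
  isCodeTagged-unique proj proj = refl
  isCodeTagged-unique (comp cf cgs) (comp cf′ cgs′) = cong₂ compᵗ (isCode-unique cf cf′ refl) (areCodes-unique cgs cgs′)
  isCodeTagged-unique (prec cg ch) (prec cg′ ch′) = cong₂ precᵗ (isCode-unique cg cg′ refl) (isCode-unique ch ch′ refl)
  isCodeTagged-unique junk junk = refl

  areCodes-unique : ∀ {l gs gs′} → AreCodes l gs → AreCodes l gs′ → gs ≡ gs′
  areCodes-unique [] [] = refl
  areCodes-unique (cg ∷ cgs) (cg′ ∷ cgs′) = cong₂ _∷_ (isCode-unique cg cg′ refl) (areCodes-unique cgs cgs′)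

fst-snd-< : ∀ {p n} → p < n → fst (snd p) < n
fst-snd-< p<n = ≤-<-trans (≤-trans (fst≤ _) (snd≤ _)) p<n

snd-snd-< : ∀ {p n} → p < n → snd (snd p) < n
snd-snd-< p<n = ≤-<-trans (≤-trans (snd≤ _) (snd≤ _)) p<n

-- n bounds the code, for the termination of decoding.
mutual
  decode : ∀ n t → t < n → Σ Term (IsCode t)
  decode (suc n) zero _ = zeroᵗ , zero
  decode (suc n) (suc p) (s≤s p<n) with decodeTagged n (fst p) (snd p) (fst-snd-< p<n) (snd-snd-< p<n)
  ... | u , c = u , subst (λ q → IsCode (suc q) u) (pair-fst-snd p) (tagged c)

  decodeTagged : ∀ n tag a → fst a < n → snd a < n → Σ Term (IsCodeTagged tag a)
  decodeTagged n 0 a _ _ = succᵗ , succ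
  decodeTagged n 1 a _ _ = projᵗ a , proj
  decodeTagged n 2 a fst<n snd<n with decode n (fst a) fst<n | decodeList n (snd a) snd<n
  ... | f , cf | gs , cgs = compᵗ f gs , comp cf cgs
  decodeTagged n 3 a fst<n snd<n with decode n (fst a) fst<n | decode n (snd a) snd<n
  ... | g , cg | h , ch = precᵗ g h , prec cg ch
  decodeTagged n (suc (suc (suc (suc k)))) a _ _ = zeroᵗ , junk

  decodeList : ∀ n l → l < n → Σ (List Term) (AreCodes l)
  decodeList (suc n) zero _ = [] , []
  decodeList (suc n) (suc q) (s≤s q<n) with decode n (fst q) (≤-<-trans (fst≤ q) q<n)
                                            | decodeList n (snd q) (≤-<-trans (snd≤ q) q<n)
  ... | g , cg | gs , cgs = g ∷ gs , cg ∷ cgs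

term : ℕ → Term
term t = proj₁ (decode (suc t) t ≤-refl)

term-isCode : ∀ t → IsCode t (term t)
term-isCode t = proj₂ (decode (suc t) t ≤-refl)

mutual
  code : Term → ℕ
  code zeroᵗ = 0
  code succᵗ = suc (pair 0 0)
  code (projᵗ i) = suc (pair 1 i)
  code (compᵗ f gs) = suc (pair 2 (pair (code f) (codes gs)))
  code (precᵗ g h) = suc (pair 3 (pair (code g) (code h)))

  codes : List Term → ℕ
  codes [] = 0
  codes (g ∷ gs) = suc (pair (code g) (codes gs))

mutual
  code-isCode : ∀ u → IsCode (code u) u
  code-isCode zeroᵗ = zero
  code-isCode succᵗ = tagged succ
  code-isCode (projᵗ i) = tagged proj
  code-isCode (compᵗ f gs) = tagged (comp (subst (λ c → IsCode c f) (sym (fst-pair _ _)) (code-isCode f))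
                                          (subst (λ c → AreCodes c gs) (sym (snd-pair _ _)) (codes-areCodes gs)))
  code-isCode (precᵗ g h) = tagged (prec (subst (λ c → IsCode c g) (sym (fst-pair _ _)) (code-isCode g))
                                         (subst (λ c → IsCode c h) (sym (snd-pair _ _)) (code-isCode h)))

  codes-areCodes : ∀ gs → AreCodes (codes gs) gs
  codes-areCodes [] = []
  codes-areCodes (g ∷ gs) = subst (λ c → IsCode c g) (sym (fst-pair _ _)) (code-isCode g)
                          ∷ subst (λ c → AreCodes c gs) (sym (snd-pair _ _)) (codes-areCodes gs)

term-code : ∀ u → term (code u) ≡ u
term-code u = isCode-unique (term-isCode (code u)) (code-isCode u) refl

mutual
  toTerm : ∀ {k} → PR k → Term
  toTerm zeroF = zeroᵗ
  toTerm succF = succᵗ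
  toTerm (proj i) = projᵗ (toℕ i)
  toTerm (comp f gs) = compᵗ (toTerm f) (toTerms gs)
  toTerm (prec g h) = precᵗ (toTerm g) (toTerm h)

  toTerms : ∀ {k m} → Vec (PR k) m → List Term
  toTerms [] = []
  toTerms (g ∷ gs) = toTerm g ∷ toTerms gs

head₀-drop-toList : ∀ {k} (xs : Vec ℕ k) i → head₀ (drop (toℕ i) (toList xs)) ≡ lookup xs i
head₀-drop-toList (x ∷ xs) fzero = refl
head₀-drop-toList (x ∷ xs) (fsuc i) = head₀-drop-toList xs i

mutual
  eval-toTerm : ∀ {k} (g : PR k) xs → eval (toTerm g) (toList xs) ≡ evalPR g xs
  eval-toTerm zeroF xs = refl
  eval-toTerm succF (x ∷ []) = refl
  eval-toTerm (proj i) xs = head₀-drop-toList xs i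
  eval-toTerm (comp f gs) xs = trans (cong (eval (toTerm f)) (evals-toTerms gs xs)) (eval-toTerm f (evalPRs gs xs))
  eval-toTerm (prec g h) (y ∷ xs) = evalRec-toTerm g h y xs

  evals-toTerms : ∀ {k m} (gs : Vec (PR k) m) xs → evals (toTerms gs) (toList xs) ≡ toList (evalPRs gs xs)
  evals-toTerms [] xs = refl
  evals-toTerms (g ∷ gs) xs = cong₂ _∷_ (eval-toTerm g xs) (evals-toTerms gs xs)

  evalRec-toTerm : ∀ {k} (g : PR k) h y (xs : Vec ℕ k) →
                   evalRec (toTerm g) (toTerm h) y (toList xs) ≡ evalPR (prec g h) (y ∷ xs)
  evalRec-toTerm g h zero xs = eval-toTerm g xs
  evalRec-toTerm g h (suc y) xs =
    trans (cong (λ r → eval (toTerm h) (y ∷ r ∷ toList xs)) (evalRec-toTerm g h y xs)) (eval-toTerm h (y ∷ _ ∷ xs))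

bitOf : ℕ → ℕ → ℕ
bitOf w i = bitℕ (testbit w i)

parity-suc : ∀ n → bitℕ (parity (suc n)) ≡ 1 ∸ bitℕ (parity n)
parity-suc zero = refl
parity-suc (suc zero) = refl
parity-suc (suc (suc n)) = parity-suc n

half-suc : ∀ n → ⌊ suc n /2⌋ ≡ ⌊ n /2⌋ + bitℕ (parity n)
half-suc zero = refl
half-suc (suc zero) = refl
half-suc (suc (suc n)) = cong suc (half-suc n)

parityᶜ : Computable₁ (bitℕ ∘ parity)
parityᶜ = computable₁-ext agree (primRec₁ᶜ {0} {λ _ r → 1 ∸ r} (computable₂ (apply₂ ∸ᶜ (constᶜ 1) (varᶜ (# 1)))))
  where
  agree : ∀ n → primRec₁ 0 (λ _ r → 1 ∸ r) n ≡ bitℕ (parity n)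
  agree zero = refl
  agree (suc n) = trans (cong (1 ∸_) (agree n)) (sym (parity-suc n))

halfᶜ : Computable₁ ⌊_/2⌋
halfᶜ = computable₁-ext agree
  (primRec₁ᶜ {0} {λ n r → r + bitℕ (parity n)} (computable₂ (apply₂ +ᶜ (varᶜ (# 1)) (apply₁ parityᶜ (varᶜ (# 0))))))
  where
  agree : ∀ n → primRec₁ 0 (λ n r → r + bitℕ (parity n)) n ≡ ⌊ n /2⌋
  agree zero = refl
  agree (suc n) = trans (cong (_+ bitℕ (parity n)) (agree n)) (sym (half-suc n))

testbit-fold : ∀ w i → testbit w i ≡ parity (fold w ⌊_/2⌋ i)
testbit-fold w zero = refl
testbit-fold w (suc i) = trans (testbit-fold ⌊ w /2⌋ i) (cong parity (fold-shift ⌊_/2⌋ w i))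

bitOfᶜ : Computable₂ bitOf
bitOfᶜ = computable₂-ext (λ w i → cong bitℕ (sym (testbit-fold w i)))
  (computable₂ (apply₁ parityᶜ (apply₂ (foldᶜ halfᶜ) (varᶜ (# 1)) (varᶜ (# 0)))))

varsᶜ : ∀ {k m} (ρ : Fin m → Fin k) → Computable* k m (λ v → tabulate (λ i → lookup v (ρ i)))
varsᶜ {m = zero} ρ = []ᶜ
varsᶜ {m = suc m} ρ = varᶜ (ρ fzero) ∷ᶜ varsᶜ (ρ ∘ fsuc)

-- p at the index n and the parameters xs, inside the step of a recursion on n ∷ r ∷ xs
stepArgᶜ : ∀ {k p} → Computable (suc k) p →
           Computable (suc (suc k)) (λ v → p (lookup v (# 0) ∷ tabulate (λ i → lookup v (fsuc (fsuc i)))))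
stepArgᶜ cp = composeᶜ cp (varᶜ (# 0) ∷ᶜ varsᶜ (fsuc ∘ fsuc))

sumBelow : (ℕ → ℕ) → ℕ → ℕ
sumBelow f zero = 0
sumBelow f (suc n) = sumBelow f n + f n

sumBelowᶜ : ∀ {k p} → Computable (suc k) p → Computable (suc k) (λ v → sumBelow (λ i → p (i ∷ tail v)) (head v))
sumBelowᶜ {p = p} cp = computable-ext agree (primRecᶜ (constᶜ 0) (apply₂ +ᶜ (varᶜ (# 1)) (stepArgᶜ cp)))
  where
  agree : ∀ v → primRec _ _ v ≡ sumBelow (λ i → p (i ∷ tail v)) (head v)
  agree (zero ∷ xs) = refl
  agree (suc n ∷ xs) = cong₂ _+_ (agree (n ∷ xs)) (cong (λ ys → p (n ∷ ys)) (tabulate∘lookup xs))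

sumBelow-zero : ∀ f n → sumBelow f n ≡ 0 → ∀ k → k < n → f k ≡ 0
sumBelow-zero f (suc n) sum≡0 k k<1+n with m≤n⇒m<n∨m≡n (≤-pred k<1+n)
... | inj₁ k<n = sumBelow-zero f n (m+n≡0⇒m≡0 (sumBelow f n) sum≡0) k k<n
... | inj₂ refl = m+n≡0⇒n≡0 (sumBelow f n) sum≡0

sumBelow-nonzero : ∀ f n → sumBelow f n ≢ 0 → ∃ λ k → k < n × f k ≢ 0
sumBelow-nonzero f zero sum≢0 = ⊥-elim (sum≢0 refl)
sumBelow-nonzero f (suc n) sum≢0 with f n in fn≡
... | suc _ = n , ≤-refl , λ fn≡0 → 0≢1+n (trans (sym fn≡0) fn≡)
... | zero with sumBelow-nonzero f n (λ sum≡0 → sum≢0 (trans (+-identityʳ (sumBelow f n)) sum≡0))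
...   | k , k<n , fk≢0 = k , m≤n⇒m≤1+n k<n , fk≢0

-- search p n is 1 + the least i < n with p i ≡ 0, or 0 if there is none.
search : (ℕ → ℕ) → ℕ → ℕ
search p zero = 0
search p (suc n) = ifZero search p n then (ifZero p n then suc n else 0) else search p n

searchᶜ : ∀ {k p} → Computable (suc k) p → Computable (suc k) (λ v → search (λ i → p (i ∷ tail v)) (head v))
searchᶜ {p = p} cp = computable-ext agree (primRecᶜ (constᶜ 0)
  (apply₃ ifZeroᶜ (varᶜ (# 1)) (apply₃ ifZeroᶜ (stepArgᶜ cp) (apply₁ sucᶜ (varᶜ (# 0))) (constᶜ 0)) (varᶜ (# 1))))
  where
  agree : ∀ v → primRec _ _ v ≡ search (λ i → p (i ∷ tail v)) (head v)
  agree (zero ∷ xs) = refl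
  agree (suc n ∷ xs) = cong₂ (λ r q → ifZero r then (ifZero q then suc n else 0) else r)
                             (agree (n ∷ xs)) (cong (λ ys → p (n ∷ ys)) (tabulate∘lookup xs))

search-found : ∀ p n i → search p n ≡ suc i → p i ≡ 0 × i < n × search p i ≡ 0
search-found p (suc n) i found with search p n in prev
... | suc i′ with search-found p n i′ prev
...   | pi′≡0 , i′<n , least rewrite suc-injective (sym found) = pi′≡0 , m≤n⇒m≤1+n i′<n , least
search-found p (suc n) i found | zero with p n in pn≡
...   | zero rewrite suc-injective (sym found) = pn≡ , ≤-refl , prev
search-found p (suc n) i () | zero | suc _

search-none : ∀ p n → search p n ≡ 0 → ∀ i → i < n → p i ≢ 0
search-none p (suc n) none i i<1+n pi≡0 with search p n in prev
search-none p (suc n) () i i<1+n pi≡0 | suc _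
... | zero with m≤n⇒m<n∨m≡n (≤-pred i<1+n)
...   | inj₁ i<n = search-none p n prev i i<n pi≡0
...   | inj₂ refl with p i
search-none p (suc n) () i i<1+n pi≡0 | zero | inj₂ refl | zero
search-none p (suc n) none i i<1+n () | zero | inj₂ refl | suc _

-- The index idx of the string formed by the first k bits of w.
prefixIndex : ℕ → ℕ → ℕ
prefixIndex w k = sumBelow (λ i → suc (bitOf w i) * 2 ^ i) k

prefixIndexᶜ : Computable₂ prefixIndex
prefixIndexᶜ = computable₂ (composeᶜ
  (sumBelowᶜ (apply₂ *ᶜ (apply₁ sucᶜ (apply₂ bitOfᶜ (varᶜ (# 1)) (varᶜ (# 0)))) (apply₁ 2^ᶜ (varᶜ (# 0)))))
  (varᶜ (# 1) ∷ᶜ varᶜ (# 0) ∷ᶜ []ᶜ))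

hits : ℕ → ℕ → ℕ → ℕ
hits c L w = sumBelow (λ k → bitOf c (prefixIndex w k)) (suc L)

hitsᶜ : Computable₃ hits
hitsᶜ = computable₃ (composeᶜ
  (sumBelowᶜ (apply₂ bitOfᶜ (varᶜ (# 1)) (apply₂ prefixIndexᶜ (varᶜ (# 2)) (varᶜ (# 0)))))
  (apply₁ sucᶜ (varᶜ (# 1)) ∷ᶜ varᶜ (# 0) ∷ᶜ varᶜ (# 2) ∷ᶜ []ᶜ))

-- The hits of the string of the first len bits of v followed by the c + 1 low bits of j.
extensionHits : ℕ → ℕ → ℕ → ℕ → ℕ
extensionHits c len v j = hits c (len + suc c) (v + 2 ^ len * j)

-- The least such j < 2 ^ (1 + c) without hits (0 if there is none).
extension : ℕ → ℕ → ℕ → ℕ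
extension c len v = pred (search (extensionHits c len v) (2 ^ suc c))

extensionᶜ : Computable₃ extension
extensionᶜ = computable₃ (apply₁ predᶜ (composeᶜ
  (searchᶜ (apply₃ hitsᶜ (varᶜ (# 1)) (apply₂ +ᶜ (varᶜ (# 2)) (apply₁ sucᶜ (varᶜ (# 1))))
                         (apply₂ +ᶜ (varᶜ (# 3)) (apply₂ *ᶜ (apply₁ 2^ᶜ (varᶜ (# 2))) (varᶜ (# 0))))))
  (apply₁ 2^ᶜ (apply₁ sucᶜ (varᶜ (# 0))) ∷ᶜ varᶜ (# 0) ∷ᶜ varᶜ (# 1) ∷ᶜ varᶜ (# 2) ∷ᶜ []ᶜ)))

-- The stages

-- At stage E the first stageLength τ E bits of stageBits τ E are decided; they are extended so
-- as to avoid the set coded by τ E (1 + stageLength τ E), the value of the E-th test there.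
stageLength : (ℕ → ℕ → ℕ) → ℕ → ℕ
stageLength τ zero = 0
stageLength τ (suc E) = stageLength τ E + suc (τ E (suc (stageLength τ E)))

stageBits : (ℕ → ℕ → ℕ) → ℕ → ℕ
stageBits τ zero = 0
stageBits τ (suc E) =
  stageBits τ E + 2 ^ stageLength τ E * extension (τ E (suc (stageLength τ E))) (stageLength τ E) (stageBits τ E)

testAt : ℕ → ℕ → ℕ
testAt E n = eval (term E) (n ∷ [])

X : Real
X m = testbit (stageBits testAt (suc m)) m

start : ℕ → ℕ → ℕ
start E n = pair (cons (evalInstr E (encode (n ∷ []))) 0) 0

halt : ℕ → ℕ
halt v = pair 0 (cons v 0)

run : ℕ → ℕ → ℕ → ℕ
run F E n = fold (start E n) step F

fuelledTestAt : ℕ → ℕ → ℕ → ℕ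
fuelledTestAt F E n = hd (snd (run F E n))

unhalted : ℕ → ℕ → ℕ → ℕ
unhalted F E n = fst (run F E n)

unhaltedBelow : ℕ → ℕ → ℕ
unhaltedBelow F E = sumBelow (λ E′ → unhalted F E′ (suc (stageLength (fuelledTestAt F) E′))) E

runᶜ : Computable₃ run
runᶜ = computable₃ (apply₂ (foldᶜ stepᶜ) (varᶜ (# 0))
  (apply₂ pairᶜ (apply₂ consᶜ (evalInstrᶜ (varᶜ (# 1)) (apply₂ consᶜ (varᶜ (# 2)) (constᶜ 0))) (constᶜ 0)) (constᶜ 0)))

fuelledTestAtᶜ : Computable₃ fuelledTestAt
fuelledTestAtᶜ = computable₃ (apply₁ hdᶜ (apply₁ sndᶜ (apply₃ runᶜ (varᶜ (# 0)) (varᶜ (# 1)) (varᶜ (# 2)))))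

unhaltedᶜ : Computable₃ unhalted
unhaltedᶜ = computable₃ (apply₁ fstᶜ (apply₃ runᶜ (varᶜ (# 0)) (varᶜ (# 1)) (varᶜ (# 2))))

fuelledLengthᶜ : Computable₂ (λ E F → stageLength (fuelledTestAt F) E)
fuelledLengthᶜ = computable₂-ext agree (primRec₂ᶜ {h = λ E ℓ F → ℓ + suc (fuelledTestAt F E (suc ℓ))}
  (computable₁ (constᶜ 0))
  (computable₃ (apply₂ +ᶜ (varᶜ (# 1)) (apply₁ sucᶜ (apply₃ fuelledTestAtᶜ (varᶜ (# 2)) (varᶜ (# 0)) (apply₁ sucᶜ (varᶜ (# 1))))))))
  where
  agree : ∀ E F → primRec₂ (λ _ → 0) (λ E ℓ F → ℓ + suc (fuelledTestAt F E (suc ℓ))) E F ≡ stageLength (fuelledTestAt F) E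
  agree zero F = refl
  agree (suc E) F = cong (λ ℓ → ℓ + suc (fuelledTestAt F E (suc ℓ))) (agree E F)

fuelledBitsᶜ : Computable₂ (λ E F → stageBits (fuelledTestAt F) E)
fuelledBitsᶜ = computable₂-ext agree (primRec₂ᶜ {h = step′} (computable₁ (constᶜ 0)) (computable₃
  (apply₂ +ᶜ v (apply₂ *ᶜ (apply₁ 2^ᶜ ℓ) (apply₃ extensionᶜ (apply₃ fuelledTestAtᶜ F E (apply₁ sucᶜ ℓ)) ℓ v)))))
  where
  step′ : ℕ → ℕ → ℕ → ℕ
  step′ E v F = let ℓ = stageLength (fuelledTestAt F) E in v + 2 ^ ℓ * extension (fuelledTestAt F E (suc ℓ)) ℓ v
  E = varᶜ (# 0); v = varᶜ (# 1); F = varᶜ (# 2); ℓ = apply₂ fuelledLengthᶜ E F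
  agree : ∀ E F → primRec₂ (λ _ → 0) step′ E F ≡ stageBits (fuelledTestAt F) E
  agree zero F = refl
  agree (suc E) F = cong (λ v → step′ E v F) (agree E F)

unhaltedBelowᶜ : Computable₂ unhaltedBelow
unhaltedBelowᶜ = computable₂ (composeᶜ
  (sumBelowᶜ (apply₃ unhaltedᶜ (varᶜ (# 1)) (varᶜ (# 0)) (apply₁ sucᶜ (apply₂ fuelledLengthᶜ (varᶜ (# 0)) (varᶜ (# 1))))))
  (varᶜ (# 1) ∷ᶜ varᶜ (# 0) ∷ᶜ []ᶜ))

fold-step-final : ∀ S n → fold (pair 0 S) step n ≡ pair 0 S
fold-step-final S zero = refl
fold-step-final S (suc n) = trans (cong step (fold-step-final S n)) (step-final S)

run-halts : ∀ E n → ∃ λ N → run N E n ≡ halt (testAt E n)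
run-halts E n = ⟶*⇒fold (eval-run (term-isCode E) (n ∷ []) 0 0)

run-after : ∀ E n {N v} F → run N E n ≡ halt v → run (F + N) E n ≡ halt v
run-after E n {N} {v} F halts = begin
  fold (start E n) step (F + N)  ≡⟨ fold-+ (start E n) step F ⟩
  fold (run N E n) step F        ≡⟨ cong (λ σ → fold σ step F) halts ⟩
  fold (halt v) step F           ≡⟨ fold-step-final _ F ⟩
  halt v                         ∎
  where open ≡-Reasoning

-- A run that has halted is a fixed point of step, so it has reached the final state.
run-halted : ∀ E n {N v} F → unhalted F E n ≡ 0 → run N E n ≡ halt v → run F E n ≡ halt v
run-halted E n {N} {v} F halted halts = begin
  run F E n                       ≡⟨ final ⟩
  pair 0 (snd (run F E n))        ≡⟨ sym (fold-step-final _ N) ⟩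
  fold (pair 0 (snd (run F E n))) step N ≡⟨ cong (λ σ → fold σ step N) (sym final) ⟩
  fold (run F E n) step N         ≡⟨ sym (fold-+ (start E n) step N) ⟩
  run (N + F) E n                 ≡⟨ cong (λ F′ → run F′ E n) (+-comm N F) ⟩
  run (F + N) E n                 ≡⟨ run-after E n {N} F halts ⟩
  halt v                          ∎
  where
  open ≡-Reasoning
  final : run F E n ≡ pair 0 (snd (run F E n))
  final = trans (sym (pair-fst-snd (run F E n))) (cong (λ K → pair K (snd (run F E n))) halted)

fuelledTestAt-correct : ∀ F E n → unhalted F E n ≡ 0 → fuelledTestAt F E n ≡ testAt E n
fuelledTestAt-correct F E n halted with run-halts E n
... | N , halts = trans (cong (hd ∘ snd) (run-halted E n {N} F halted halts))
                        (trans (cong hd (snd-pair 0 _)) (fst-pair (testAt E n) 0))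

enough-fuel : ∀ E n → ∃ λ N → ∀ F → N ≤ F → unhalted F E n ≡ 0
enough-fuel E n with run-halts E n
... | N , halts = N , λ F N≤F →
  trans (cong (λ F′ → fst (run F′ E n)) (sym (m∸n+n≡m N≤F)))
        (trans (cong fst (run-after E n {N} (F ∸ N) halts)) (fst-pair 0 _))

fuelled-stages : ∀ F E → unhaltedBelow F E ≡ 0 →
  stageLength (fuelledTestAt F) E ≡ stageLength testAt E × stageBits (fuelledTestAt F) E ≡ stageBits testAt E
fuelled-stages F zero _ = refl , refl
fuelled-stages F (suc E) none with fuelled-stages F E (m+n≡0⇒m≡0 (unhaltedBelow F E) none)
... | ℓ≡ , v≡ = cong₂ (λ ℓ c → ℓ + suc c) ℓ≡ c≡ , cong₃ (λ ℓ c v → v + 2 ^ ℓ * extension c ℓ v) ℓ≡ c≡ v≡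
  where
  c≡ : fuelledTestAt F E (suc (stageLength (fuelledTestAt F) E)) ≡ testAt E (suc (stageLength testAt E))
  c≡ = trans (fuelledTestAt-correct F E _ (m+n≡0⇒n≡0 (unhaltedBelow F E) none)) (cong (testAt E ∘ suc) ℓ≡)
  cong₃ : ∀ (f : ℕ → ℕ → ℕ → ℕ) {a a′ b b′ c c′} → a ≡ a′ → b ≡ b′ → c ≡ c′ → f a b c ≡ f a′ b′ c′
  cong₃ f refl refl refl = refl

enough-fuel-below : ∀ E → ∃ λ N → ∀ F → N ≤ F → unhaltedBelow F E ≡ 0
enough-fuel-below zero = 0 , λ _ _ → refl
enough-fuel-below (suc E) with enough-fuel-below E | enough-fuel E (suc (stageLength testAt E))
... | N , below | N′ , here = N ⊔ N′ , λ F N⊔N′≤F →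
  let below≡0 = below F (≤-trans (m≤m⊔n N N′) N⊔N′≤F) in
  cong₂ _+_ below≡0 (trans (cong (λ ℓ → unhalted F E (suc ℓ)) (proj₁ (fuelled-stages F E below≡0)))
                           (here F (≤-trans (m≤n⊔m N N′) N⊔N′≤F)))

least : (ℕ → ℕ) → ℕ → ℕ
least p w = pred (search p (suc w))

least-spec : ∀ p w → p w ≡ 0 → p (least p w) ≡ 0 × (∀ j → j < least p w → ∃ λ m → p j ≡ suc m)
least-spec p w pw≡0 with search p (suc w) in found
... | zero = ⊥-elim (search-none p (suc w) found w ≤-refl pw≡0)
... | suc i with search-found p (suc w) i found
...   | pi≡0 , _ , below = pi≡0 , λ j j<i → nonzero (search-none p i below j j<i)
  where
  nonzero : ∀ {n} → n ≢ 0 → ∃ λ m → n ≡ suc m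
  nonzero {zero} n≢0 = ⊥-elim (n≢0 refl)
  nonzero {suc m} _ = m , refl

μᶜ : ∀ {k f} → Computable (suc k) f → (w : Vec ℕ k → ℕ) → (∀ xs → f (w xs ∷ xs) ≡ 0) →
     Computable k (λ xs → least (λ y → f (y ∷ xs)) (w xs))
μᶜ {f = f} (e , e⇓) w fw≡0 = muR e , λ xs →
  let zero-at , positive-below = least-spec (λ y → f (y ∷ xs)) (w xs) (fw≡0 xs) in
  ⇓mu (subst (e ⊢ (least (λ y → f (y ∷ xs)) (w xs) ∷ xs) ⇓_) zero-at (e⇓ _))
      (λ z z< → let m , fz≡ = positive-below z z< in m , subst (e ⊢ (z ∷ xs) ⇓_) fz≡ (e⇓ (z ∷ xs)))

fuelledBit : ℕ → ℕ → ℕ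
fuelledBit F m = bitOf (stageBits (fuelledTestAt F) (suc m)) m

fuelledBitᶜ : Computable₂ fuelledBit
fuelledBitᶜ = computable₂ (apply₂ bitOfᶜ (apply₂ fuelledBitsᶜ (apply₁ sucᶜ (varᶜ (# 1))) (varᶜ (# 0))) (varᶜ (# 1)))

enoughFuel : ℕ → ℕ
enoughFuel m = proj₁ (enough-fuel-below (suc m))

enoughFuel-enough : ∀ m → unhaltedBelow (enoughFuel m) (suc m) ≡ 0
enoughFuel-enough m = proj₂ (enough-fuel-below (suc m)) (enoughFuel m) ≤-refl

leastFuel : ℕ → ℕ
leastFuel m = least (λ F → unhaltedBelow F (suc m)) (enoughFuel m)

leastFuelᶜ : Computable₁ leastFuel
leastFuelᶜ = computable₁ (μᶜ (apply₂ unhaltedBelowᶜ (varᶜ (# 0)) (apply₁ sucᶜ (varᶜ (# 1))))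
                             (λ xs → enoughFuel (lookup xs (# 0))) (λ xs → enoughFuel-enough (lookup xs (# 0))))

fuelledBit-leastFuel : ∀ m → fuelledBit (leastFuel m) m ≡ bitℕ (X m)
fuelledBit-leastFuel m = cong (λ v → bitOf v m)
  (proj₂ (fuelled-stages (leastFuel m) (suc m)
    (proj₁ (least-spec (λ F → unhaltedBelow F (suc m)) (enoughFuel m) (enoughFuel-enough m)))))

Xᶜ : Computable₁ (bitℕ ∘ X)
Xᶜ = computable₁-ext fuelledBit-leastFuel
  (computable₁ (apply₂ fuelledBitᶜ (apply₁ leastFuelᶜ (varᶜ (# 0))) (varᶜ (# 0))))

X-recursive : Recursive X
X-recursive = let computable₁ (e , e⇓) = Xᶜ in e , λ m → e⇓ (m ∷ [])

parity-+-2* : ∀ a y → parity (a + 2 * y) ≡ parity a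
parity-+-2* a zero = cong parity (+-identityʳ a)
parity-+-2* a (suc y) rewrite *-suc 2 y | +-suc a (suc (2 * y)) | +-suc a (2 * y) = parity-+-2* a y

half-+-2* : ∀ a y → ⌊ a + 2 * y /2⌋ ≡ ⌊ a /2⌋ + y
half-+-2* a zero = trans (cong ⌊_/2⌋ (+-identityʳ a)) (sym (+-identityʳ _))
half-+-2* a (suc y) rewrite *-suc 2 y | +-suc a (suc (2 * y)) | +-suc a (2 * y) | +-suc ⌊ a /2⌋ y =
  cong suc (half-+-2* a y)

half-< : ∀ v l → v < 2 ^ suc l → ⌊ v /2⌋ < 2 ^ l
half-< v l v< = *-cancelˡ-< 2 _ _ (begin-strict 2 * ⌊ v /2⌋ ≤⟨ double-half v ⟩ v <⟨ v< ⟩ 2 ^ suc l ∎)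
  where
  open ≤-Reasoning
  double-half : ∀ v → 2 * ⌊ v /2⌋ ≤ v
  double-half zero = z≤n
  double-half (suc zero) = z≤n
  double-half (suc (suc v)) rewrite *-suc 2 ⌊ v /2⌋ = s≤s (s≤s (double-half v))

2^suc-* : ∀ l j → 2 ^ suc l * j ≡ 2 * (2 ^ l * j)
2^suc-* l j = *-assoc 2 (2 ^ l) j

testbit-low : ∀ l v j i → v < 2 ^ l → i < l → testbit (v + 2 ^ l * j) i ≡ testbit v i
testbit-low (suc l) v j zero _ _ = trans (cong (λ x → parity (v + x)) (2^suc-* l j)) (parity-+-2* v (2 ^ l * j))
testbit-low (suc l) v j (suc i) v< (s≤s i<l) =
  trans (cong (λ x → testbit ⌊ v + x /2⌋ i) (2^suc-* l j))
        (trans (cong (λ x → testbit x i) (half-+-2* v (2 ^ l * j))) (testbit-low l ⌊ v /2⌋ j i (half-< v l v<) i<l))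

testbit-high : ∀ l v j i → v < 2 ^ l → testbit (v + 2 ^ l * j) (l + i) ≡ testbit j i
testbit-high zero zero j i _ = cong (λ x → testbit x i) (+-identityʳ j)
testbit-high zero (suc v) j i (s≤s ())
testbit-high (suc l) v j i v< =
  trans (cong (λ x → testbit ⌊ v + x /2⌋ (l + i)) (2^suc-* l j))
        (trans (cong (λ x → testbit x (l + i)) (half-+-2* v (2 ^ l * j))) (testbit-high l ⌊ v /2⌋ j i (half-< v l v<)))

testbit-small : ∀ c i → c < 2 ^ i → testbit c i ≡ false
testbit-small zero zero _ = refl
testbit-small (suc c) zero (s≤s ())
testbit-small c (suc i) c< = testbit-small ⌊ c /2⌋ i (half-< c i c<)

n<2^n : ∀ n → n < 2 ^ n
n<2^n zero = s≤s z≤n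
n<2^n (suc n) = begin-strict
  suc n           ≤⟨ n<2^n n ⟩
  2 ^ n           <⟨ m<m+n (2 ^ n) (m^n>0 2 n) ⟩
  2 ^ n + 2 ^ n   ≡⟨ cong (2 ^ n +_) (sym (+-identityʳ (2 ^ n))) ⟩
  2 ^ suc n       ∎
  where open ≤-Reasoning

applyUpTo-cong : ∀ {A : Set} (f g : ℕ → A) n → (∀ i → i < n → f i ≡ g i) → applyUpTo f n ≡ applyUpTo g n
applyUpTo-cong f g zero f≗g = refl
applyUpTo-cong f g (suc n) f≗g =
  cong₂ _∷_ (f≗g 0 (s≤s z≤n)) (applyUpTo-cong (f ∘ suc) (g ∘ suc) n (λ i i<n → f≗g (suc i) (s≤s i<n)))

applyUpTo-+ : ∀ {A : Set} (f : ℕ → A) m n → applyUpTo f (m + n) ≡ applyUpTo f m ++ applyUpTo (λ i → f (m + i)) n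
applyUpTo-+ f zero n = refl
applyUpTo-+ f (suc m) n = cong (f 0 ∷_) (applyUpTo-+ (f ∘ suc) m n)

take-applyUpTo : ∀ {A : Set} (f : ℕ → A) k n → k ≤ n → take k (applyUpTo f n) ≡ applyUpTo f k
take-applyUpTo f zero n _ = refl
take-applyUpTo f (suc k) (suc n) (s≤s k≤n) = cong (f 0 ∷_) (take-applyUpTo (f ∘ suc) k n k≤n)

bits : ℕ → ℕ → Str
bits w l = applyUpTo (testbit w) l

bits-+-2^* : ∀ l v j m → v < 2 ^ l → bits (v + 2 ^ l * j) (l + m) ≡ bits v l ++ bits j m
bits-+-2^* l v j m v< = trans (applyUpTo-+ _ l m)
  (cong₂ _++_ (applyUpTo-cong _ _ l (λ i i<l → testbit-low l v j i v< i<l))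
              (applyUpTo-cong _ _ m (λ i _ → testbit-high l v j i v<)))

fromBits : Str → ℕ
fromBits [] = 0
fromBits (b ∷ σ) = bitℕ b + 2 * fromBits σ

fromBits-< : ∀ σ → fromBits σ < 2 ^ length σ
fromBits-< [] = s≤s z≤n
fromBits-< (b ∷ σ) = begin-strict
  bitℕ b + 2 * fromBits σ <⟨ +-monoˡ-< (2 * fromBits σ) (bit<2 b) ⟩
  2 + 2 * fromBits σ      ≡⟨ sym (*-suc 2 (fromBits σ)) ⟩
  2 * suc (fromBits σ)    ≤⟨ *-monoʳ-≤ 2 (fromBits-< σ) ⟩
  2 * 2 ^ length σ        ∎
  where
  open ≤-Reasoning
  bit<2 : ∀ b → bitℕ b < 2
  bit<2 false = s≤s z≤n
  bit<2 true = s≤s (s≤s z≤n)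

bits-fromBits : ∀ σ → bits (fromBits σ) (length σ) ≡ σ
bits-fromBits [] = refl
bits-fromBits (b ∷ σ) = cong₂ _∷_ (trans (parity-+-2* (bitℕ b) (fromBits σ)) (parity-bit b))
  (trans (applyUpTo-cong _ _ (length σ) (λ i _ → cong (λ x → testbit x i) (trans (half-+-2* (bitℕ b) (fromBits σ)) (half-bit b))))
         (bits-fromBits σ))
  where
  parity-bit : ∀ b → parity (bitℕ b) ≡ b
  parity-bit false = refl
  parity-bit true = refl
  half-bit : ∀ b → ⌊ bitℕ b /2⌋ + fromBits σ ≡ fromBits σ
  half-bit false = refl
  half-bit true = refl

idx-cons : ∀ b σ → idx (b ∷ σ) ≡ suc (bitℕ b) + 2 * idx σ
idx-cons false σ = refl
idx-cons true σ = refl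

idx-∷ʳ : ∀ σ b → idx (σ ∷ʳ b) ≡ idx σ + suc (bitℕ b) * 2 ^ length σ
idx-∷ʳ [] false = refl
idx-∷ʳ [] true = refl
idx-∷ʳ (a ∷ σ) b = begin
  idx (a ∷ (σ ∷ʳ b))                                          ≡⟨ idx-cons a (σ ∷ʳ b) ⟩
  suc (bitℕ a) + 2 * idx (σ ∷ʳ b)                             ≡⟨ cong (λ x → suc (bitℕ a) + 2 * x) (idx-∷ʳ σ b) ⟩
  suc (bitℕ a) + 2 * (idx σ + suc (bitℕ b) * 2 ^ length σ)    ≡⟨ regroup (bitℕ a) (idx σ) (suc (bitℕ b)) (2 ^ length σ) ⟩
  (suc (bitℕ a) + 2 * idx σ) + suc (bitℕ b) * (2 * 2 ^ length σ) ≡⟨ cong (_+ _) (sym (idx-cons a σ)) ⟩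
  idx (a ∷ σ) + suc (bitℕ b) * 2 ^ length (a ∷ σ)              ∎
  where
  open ≡-Reasoning
  regroup : ∀ x y z p → suc x + 2 * (y + z * p) ≡ (suc x + 2 * y) + z * (2 * p)
  regroup = solve-∀

idx-bits : ∀ w k → idx (bits w k) ≡ prefixIndex w k
idx-bits w zero = refl
idx-bits w (suc k) = begin
  idx (bits w (suc k))                                        ≡⟨ cong idx (sym (applyUpTo-∷ʳ (testbit w) k)) ⟩
  idx (bits w k ∷ʳ testbit w k)                               ≡⟨ idx-∷ʳ (bits w k) (testbit w k) ⟩
  idx (bits w k) + suc (bitOf w k) * 2 ^ length (bits w k)    ≡⟨ cong₂ (λ x l → x + suc (bitOf w k) * 2 ^ l)
                                                                       (idx-bits w k) (length-applyUpTo (testbit w) k) ⟩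
  prefixIndex w k + suc (bitOf w k) * 2 ^ k                   ∎
  where open ≡-Reasoning

length≤idx : ∀ σ → length σ ≤ idx σ
length≤idx [] = z≤n
length≤idx (b ∷ σ) rewrite idx-cons b σ = s≤s (≤-trans (length≤idx σ) (≤-trans (m≤m+n (idx σ) _) (m≤n+m (2 * idx σ) (bitℕ b))))

∈S-long : ∀ c σ → c < length σ → σ ∈S c ≡ false
∈S-long c σ c< = testbit-small c (idx σ) (<-≤-trans c< (≤-trans (length≤idx σ) (<⇒≤ (n<2^n (idx σ)))))

sum-strings-suc : ∀ (P : Str → ℕ) L →
  sum (map P (strings (suc L))) ≡ sum (map (λ σ → P (false ∷ σ) + P (true ∷ σ)) (strings L))
sum-strings-suc P L = go (strings L)
  where
  go : ∀ σs → sum (map P (concatMap (λ σ → (false ∷ σ) ∷ (true ∷ σ) ∷ []) σs))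
              ≡ sum (map (λ σ → P (false ∷ σ) + P (true ∷ σ)) σs)
  go [] = refl
  go (σ ∷ σs) = trans (sym (+-assoc (P (false ∷ σ)) _ _)) (cong (P (false ∷ σ) + P (true ∷ σ) +_) (go σs))

sum-map-mono : ∀ (P Q : Str → ℕ) σs → (∀ σ → P σ ≤ Q σ) → sum (map P σs) ≤ sum (map Q σs)
sum-map-mono P Q [] P≤Q = z≤n
sum-map-mono P Q (σ ∷ σs) P≤Q = +-mono-≤ (P≤Q σ) (sum-map-mono P Q σs P≤Q)

sum-strings-≥ : ∀ ℓ m (P : Str → ℕ) → (∀ σ → length σ ≡ ℓ → m ≤ P σ) → m * 2 ^ ℓ ≤ sum (map P (strings ℓ))
sum-strings-≥ zero m P m≤P = begin
  m * 1      ≡⟨ *-identityʳ m ⟩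
  m          ≤⟨ m≤P [] refl ⟩
  P []       ≡⟨ sym (+-identityʳ (P [])) ⟩
  P [] + 0   ∎
  where open ≤-Reasoning
sum-strings-≥ (suc ℓ) m P m≤P = begin
  m * (2 * 2 ^ ℓ)   ≡⟨ sym (*-assoc m 2 (2 ^ ℓ)) ⟩
  m * 2 * 2 ^ ℓ     ≤⟨ sum-strings-≥ ℓ (m * 2) (λ σ → P (false ∷ σ) + P (true ∷ σ)) both ⟩
  sum (map (λ σ → P (false ∷ σ) + P (true ∷ σ)) (strings ℓ)) ≡⟨ sym (sum-strings-suc P ℓ) ⟩
  sum (map P (strings (suc ℓ))) ∎
  where
  open ≤-Reasoning
  both : ∀ σ → length σ ≡ ℓ → m * 2 ≤ P (false ∷ σ) + P (true ∷ σ)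
  both σ |σ|≡ℓ = ≤-trans (≤-reflexive (trans (*-comm m 2) (cong (m +_) (+-identityʳ m))))
                         (+-mono-≤ (m≤P _ (cong suc |σ|≡ℓ)) (m≤P _ (cong suc |σ|≡ℓ)))

sum-strings-extensions-≥ : ∀ ρ ℓ m (P : Str → ℕ) → (∀ σ → length σ ≡ ℓ → m ≤ P (ρ ++ σ)) →
                           m * 2 ^ ℓ ≤ sum (map P (strings (length ρ + ℓ)))
sum-strings-extensions-≥ [] ℓ m P m≤P = sum-strings-≥ ℓ m P m≤P
sum-strings-extensions-≥ (a ∷ ρ) ℓ m P m≤P = begin
  m * 2 ^ ℓ                                       ≤⟨ sum-strings-extensions-≥ ρ ℓ m (λ σ → P (a ∷ σ)) m≤P ⟩
  sum (map (λ σ → P (a ∷ σ)) (strings n))         ≤⟨ sum-map-mono _ _ (strings n) (either a) ⟩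
  sum (map (λ σ → P (false ∷ σ) + P (true ∷ σ)) (strings n)) ≡⟨ sym (sum-strings-suc P n) ⟩
  sum (map P (strings (suc n)))                   ∎
  where
  open ≤-Reasoning
  n = length ρ + ℓ
  either : ∀ a σ → P (a ∷ σ) ≤ P (false ∷ σ) + P (true ∷ σ)
  either false σ = m≤m+n _ _
  either true σ = m≤n+m _ _

any-applyUpTo : ∀ (p : ℕ → Bool) f n k → k < n → p (f k) ≡ true → any p (applyUpTo f n) ≡ true
any-applyUpTo p f (suc n) zero _ pfk rewrite pfk = refl
any-applyUpTo p f (suc n) (suc k) (s≤s k<n) pfk
  rewrite any-applyUpTo p (f ∘ suc) n k k<n pfk = ∨-zeroʳ (p (f 0))

bitOf≢0 : ∀ c i → bitOf c i ≢ 0 → testbit c i ≡ true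
bitOf≢0 c i b≢0 with testbit c i
... | true = refl
... | false = ⊥-elim (b≢0 refl)

hits≢0⇒hasPrefixIn : ∀ c L w → hits c L w ≢ 0 → hasPrefixIn (bits w L) c ≡ true
hits≢0⇒hasPrefixIn c L w hits≢0 with sumBelow-nonzero (λ k → bitOf c (prefixIndex w k)) (suc L) hits≢0
... | k , k≤L , hit = subst (λ n → any (λ k → take k (bits w L) ∈S c) (upTo (suc n)) ≡ true)
  (sym (length-applyUpTo (testbit w) L))
  (any-applyUpTo _ (λ i → i) (suc L) k k≤L (begin
    testbit c (idx (take k (bits w L))) ≡⟨ cong (testbit c ∘ idx) (take-applyUpTo (testbit w) k L (≤-pred k≤L)) ⟩
    testbit c (idx (bits w k))          ≡⟨ cong (testbit c) (idx-bits w k) ⟩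
    testbit c (prefixIndex w k)         ≡⟨ bitOf≢0 c (prefixIndex w k) hit ⟩
    true                                ∎))
  where open ≡-Reasoning

hits≡0⇒∉ : ∀ c L w k → hits c L w ≡ 0 → k ≤ L → bits w k ∈S c ≢ true
hits≡0⇒∉ c L w k none k≤L ∈ = 0≢1+n (begin
  0                                ≡⟨ sym (sumBelow-zero (λ k → bitOf c (prefixIndex w k)) (suc L) none k (s≤s k≤L)) ⟩
  bitOf c (prefixIndex w k)        ≡⟨ cong (bitℕ ∘ testbit c) (sym (idx-bits w k)) ⟩
  bitℕ (bits w k ∈S c)             ≡⟨ cong bitℕ ∈ ⟩
  1                                ∎)
  where open ≡-Reasoning

extension-< : ∀ c ℓ v → extension c ℓ v < 2 ^ suc c
extension-< c ℓ v with search (extensionHits c ℓ v) (2 ^ suc c) in found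
... | zero = m^n>0 2 (suc c)
... | suc i = proj₁ (proj₂ (search-found (extensionHits c ℓ v) (2 ^ suc c) i found))

-- If all extensions by c + 1 bits of the first ℓ bits of v met the set coded by c, its
-- measure would be at least 2 ^ -ℓ.
all-extensions-hit⇒count-≥ : ∀ c ℓ v → v < 2 ^ ℓ → (∀ j → j < 2 ^ suc c → extensionHits c ℓ v j ≢ 0) →
                             2 ^ suc c ≤ count c (ℓ + suc c)
all-extensions-hit⇒count-≥ c ℓ v v< all-hit = subst (λ n → 2 ^ suc c ≤ count c (n + suc c)) (length-applyUpTo (testbit v) ℓ)
  (≤-trans (≤-reflexive (sym (+-identityʳ (2 ^ suc c))))
           (sum-strings-extensions-≥ (bits v ℓ) (suc c) 1 _ extension-hits))
  where
  extension-hits : ∀ σ → length σ ≡ suc c → 1 ≤ (if hasPrefixIn (bits v ℓ ++ σ) c then 1 else 0)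
  extension-hits σ |σ|≡ = ≤-reflexive (sym (cong (λ b → if b then 1 else 0) (begin
    hasPrefixIn (bits v ℓ ++ σ) c ≡⟨ cong (λ τ → hasPrefixIn (bits v ℓ ++ τ) c) (sym (bits-fromBits σ)) ⟩
    hasPrefixIn (bits v ℓ ++ bits (fromBits σ) (length σ)) c
      ≡⟨ cong (λ n → hasPrefixIn (bits v ℓ ++ bits (fromBits σ) n) c) |σ|≡ ⟩
    hasPrefixIn (bits v ℓ ++ bits (fromBits σ) (suc c)) c ≡⟨ cong (λ τ → hasPrefixIn τ c) (sym (bits-+-2^* ℓ v _ (suc c) v<)) ⟩
    hasPrefixIn (bits (v + 2 ^ ℓ * fromBits σ) (ℓ + suc c)) c
      ≡⟨ hits≢0⇒hasPrefixIn c (ℓ + suc c) (v + 2 ^ ℓ * fromBits σ) (all-hit (fromBits σ) (subst (λ n → fromBits σ < 2 ^ n) |σ|≡ (fromBits-< σ))) ⟩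
    true ∎)))
    where open ≡-Reasoning

count-≥⇒¬MeasureLE : ∀ c ℓ → 2 ^ suc c ≤ count c (ℓ + suc c) → ¬ MeasureLE c (suc ℓ)
count-≥⇒¬MeasureLE c ℓ many small = <-irrefl refl (begin-strict
  2 ^ L                     <⟨ m<m+n (2 ^ L) (m^n>0 2 L) ⟩
  2 ^ L + 2 ^ L             ≡⟨ cong (2 ^ L +_) (sym (+-identityʳ (2 ^ L))) ⟩
  2 ^ suc L                 ≡⟨ cong (2 ^_) (trans (cong suc (+-comm ℓ (suc c))) (sym (+-suc (suc c) ℓ))) ⟩
  2 ^ (suc c + suc ℓ)       ≡⟨ ^-distribˡ-+-* 2 (suc c) (suc ℓ) ⟩
  2 ^ suc c * 2 ^ suc ℓ     ≤⟨ *-monoˡ-≤ (2 ^ suc ℓ) many ⟩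
  count c L * 2 ^ suc ℓ     ≤⟨ small L ⟩
  2 ^ L                     ∎)
  where
  open ≤-Reasoning
  L = ℓ + suc c

extension-avoids : ∀ c ℓ v → MeasureLE c (suc ℓ) → v < 2 ^ ℓ → extensionHits c ℓ v (extension c ℓ v) ≡ 0
extension-avoids c ℓ v small v< with search (extensionHits c ℓ v) (2 ^ suc c) in found
... | zero = ⊥-elim (count-≥⇒¬MeasureLE c ℓ
                       (all-extensions-hit⇒count-≥ c ℓ v v< (search-none (extensionHits c ℓ v) (2 ^ suc c) found)) small)
... | suc i = proj₁ (search-found (extensionHits c ℓ v) (2 ^ suc c) i found)

stageBits-< : ∀ τ E → stageBits τ E < 2 ^ stageLength τ E
stageBits-< τ zero = s≤s z≤n
stageBits-< τ (suc E) = begin-strict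
  v + 2 ^ ℓ * j        <⟨ +-monoˡ-< (2 ^ ℓ * j) (stageBits-< τ E) ⟩
  2 ^ ℓ + 2 ^ ℓ * j    ≡⟨ sym (*-suc (2 ^ ℓ) j) ⟩
  2 ^ ℓ * suc j        ≤⟨ *-monoʳ-≤ (2 ^ ℓ) (extension-< c ℓ v) ⟩
  2 ^ ℓ * 2 ^ suc c    ≡⟨ sym (^-distribˡ-+-* 2 ℓ (suc c)) ⟩
  2 ^ (ℓ + suc c)      ∎
  where
  open ≤-Reasoning
  ℓ = stageLength τ E
  v = stageBits τ E
  c = τ E (suc ℓ)
  j = extension c ℓ v

E≤stageLength : ∀ τ E → E ≤ stageLength τ E
E≤stageLength τ zero = z≤n
E≤stageLength τ (suc E) = ≤-trans (s≤s (≤-trans (E≤stageLength τ E) (m≤m+n _ _))) (≤-reflexive (sym (+-suc _ _)))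

stageLength-mono : ∀ τ {E E′} → E ≤ E′ → stageLength τ E ≤ stageLength τ E′
stageLength-mono τ {E} {E′} E≤E′ with m≤n⇒m<n∨m≡n E≤E′
... | inj₂ refl = ≤-refl
stageLength-mono τ {E} {suc E′} _ | inj₁ (s≤s E≤E′) = ≤-trans (stageLength-mono τ E≤E′) (m≤m+n _ _)

testbit-stageBits : ∀ τ E E′ i → E ≤ E′ → i < stageLength τ E → testbit (stageBits τ E′) i ≡ testbit (stageBits τ E) i
testbit-stageBits τ E E′ i E≤E′ i< with m≤n⇒m<n∨m≡n E≤E′
... | inj₂ refl = refl
testbit-stageBits τ E (suc E′) i _ i< | inj₁ (s≤s E≤E′) =
  trans (testbit-low _ _ _ i (stageBits-< τ E′) (<-≤-trans i< (stageLength-mono τ E≤E′)))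
        (testbit-stageBits τ E E′ i E≤E′ i<)

X-testbit : ∀ E i → i < stageLength testAt E → X i ≡ testbit (stageBits testAt E) i
X-testbit E i i< with ≤-total (suc i) E
... | inj₁ 1+i≤E = sym (testbit-stageBits testAt (suc i) E i 1+i≤E (E≤stageLength testAt (suc i)))
... | inj₂ E≤1+i = testbit-stageBits testAt E (suc i) i E≤1+i i<

X↾≡bits : ∀ E k → k ≤ stageLength testAt E → X ↾ k ≡ bits (stageBits testAt E) k
X↾≡bits E k k≤ = trans (map-upTo X k) (applyUpTo-cong _ _ k λ i i<k → X-testbit E i (<-≤-trans i<k k≤))

length-↾ : ∀ (Y : Real) k → length (Y ↾ k) ≡ k
length-↾ Y k = trans (cong length (map-upTo Y k)) (length-applyUpTo Y k)

X-avoids : ∀ E → let c = testAt E (suc (stageLength testAt E)) in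
           MeasureLE c (suc (stageLength testAt E)) → ¬ (X ∈[ c ])
X-avoids E small (k , X↾k∈) = [ short , long ] (≤-total k (ℓ + suc c))
  where
  ℓ = stageLength testAt E
  c = testAt E (suc ℓ)
  short : k ≤ ℓ + suc c → ⊥
  short k≤L = hits≡0⇒∉ c (ℓ + suc c) (stageBits testAt (suc E)) k
                       (extension-avoids c ℓ (stageBits testAt E) small (stageBits-< testAt E)) k≤L
                       (trans (cong (_∈S c) (sym (X↾≡bits (suc E) k k≤L))) X↾k∈)
  long : ℓ + suc c ≤ k → ⊥
  long L≤k with trans (sym X↾k∈) (∈S-long c (X ↾ k) (begin-strict
    c             <⟨ s≤s (m≤n+m c ℓ) ⟩
    suc (ℓ + c)   ≡⟨ sym (+-suc ℓ c) ⟩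
    ℓ + suc c     ≤⟨ L≤k ⟩
    k             ≡⟨ sym (length-↾ X k) ⟩
    length (X ↾ k) ∎))
    where open ≤-Reasoning
  ... | ()

testAt-code : ∀ (g : PR 1) n → testAt (code (toTerm g)) n ≡ evalPR g (n ∷ [])
testAt-code g n = trans (cong (λ u → eval u (n ∷ [])) (term-code (toTerm g))) (eval-toTerm g (n ∷ []))

X-BPRandom : BPRandom X
X-BPRandom g test = suc ℓ , subst (λ c → ¬ X ∈[ c ]) (testAt-code g (suc ℓ))
  (X-avoids E (subst (λ c → MeasureLE c (suc ℓ)) (sym (testAt-code g (suc ℓ))) (test (suc ℓ))))
  where
  E = code (toTerm g)
  ℓ = stageLength testAt E

theorem2p7 : Σ Real λ X → Recursive X × BPRandom X
theorem2p7 = X , X-recursive , X-BPRandom
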